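{- Let $W$ be a positive integer and $\vec w=(w_1,\ldots,w_n)$ a vector of positive integers with $\sum_{j=1}^n w_j=W$. Then for each $i=1,\ldots,n-1$, \[ \sum_{F'\in\mathcal{F}_{n,i}}\ \sum_{F\in\mathcal{F}_{n,i+1}}\varphi(F',F)\ =\ \sum_{F\in\mathcal{F}_{n,i+1}}\mathrm{mass}(F)\ =\ K\cdot\mathbf{P}(\mathbf{F}\in\mathcal{F}_{n,i+1}). \]
   Context: Let $\mathcal{F}_n$ be the set of forests on vertex set $\{1,\ldots,n\}$; for $F\in\mathcal{F}_n$ let $\mathrm{mass}(F)=\prod_{i=1}^n w_i^{d_F(i)}$ ($d_F(i)$ the degree of $i$ in $F$), $K=\sum_{F\in\mathcal{F}_n}\mathrm{mass}(F)$, and let $\mathbf{F}$ be the random element of $\mathcal{F}_n$ with $\mathbf{P}(\mathbf{F}=F)=\mathrm{mass}(F)/K$. $\mathcal{F}_{n,i}$ is the set of forests in $\mathcal{F}_n$ with exactly $i$ components. For a forest $F$, $c(F)$ is its set of connected components, and for a component $T$ let $w(T)=\sum_{j\in V(T)}w_j$. For $F,F'\in\mathcal{F}_n$ such that $F'$ is obtained from $F$ by adding one edge, set \[ \varphi(F',F)=\frac{\mathrm{mass}(F')}{\sum_{\{T,T'\}\subseteq c(F),\,T\ne T'} w(T)w(T')}, \] the sum being over unordered pairs of distinct components of $F$; for all other pairs $(F',F)$ set $\varphi(F',F)=0$. -}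

module Defs where

open import Data.Nat using (ℕ; zero; suc; _+_; _*_; _^_; _<ᵇ_; _≡ᵇ_; NonZero)
open import Data.Bool using (Bool; true; false; _∧_; _∨_; not; if_then_else_)
open import Data.Fin using (Fin; toℕ)
open import Data.Fin.Properties using () renaming (_≟_ to _≟ᶠ_)
open import Data.Product using (_×_; _,_; proj₁; proj₂)
open import Data.List using (List; []; _∷_; _++_; map; foldr; allFin; concatMap; length)
open import Data.Bool.ListAction using (any; all)
open import Data.Nat.ListAction using (sum; product)
open import Relation.Nullary.Decidable using (isYes)
open import Data.Integer using (+_)
open import Data.Rational using (ℚ; 0ℚ; _/_) renaming (_+_ to _+ℚ_)

-- Vertices are Fin n (the paper's {1,…,n}); a potential edge {u,v} is
-- stored canonically as the ordered pair (u , v) with toℕ u < toℕ v.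
Edge : ℕ → Set
Edge n = Fin n × Fin n

_==ᶠ_ : ∀ {n} → Fin n → Fin n → Bool
a ==ᶠ b = isYes (a ≟ᶠ b)

boolFilter : ∀ {A : Set} → (A → Bool) → List A → List A
boolFilter p [] = []
boolFilter p (x ∷ xs) = if p x then x ∷ boolFilter p xs else boolFilter p xs

_==ₑ_ : ∀ {n} → Edge n → Edge n → Bool
(a , b) ==ₑ (c , d) = (a ==ᶠ c) ∧ (b ==ᶠ d)

_∈ₑ_ : ∀ {n} → Edge n → List (Edge n) → Bool
e ∈ₑ G = any (e ==ₑ_) G

allEdges : (n : ℕ) → List (Edge n)
allEdges n = concatMap (λ u → map (λ v → (u , v)) (boolFilter (λ v → toℕ u <ᵇ toℕ v) (allFin n))) (allFin n)

-- all sublists (= all subsets, since the list is duplicate-free)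
subsets : ∀ {A : Set} → List A → List (List A)
subsets [] = [] ∷ []
subsets (x ∷ xs) = subsets xs ++ map (x ∷_) (subsets xs)

allGraphs : (n : ℕ) → List (List (Edge n))
allGraphs n = subsets (allEdges n)

conn : ∀ {n} → List (Edge n) → ℕ → Fin n → Fin n → Bool
conn G zero u v = u ==ᶠ v
conn G (suc k) u v =
  conn G k u v ∨ any (λ e → (conn G k u (proj₁ e) ∧ (proj₂ e ==ᶠ v))
                          ∨ (conn G k u (proj₂ e) ∧ (proj₁ e ==ᶠ v))) G

-- u and v lie in the same connected component of G (walks of length ≤ n suffice)
connected : ∀ {n} → List (Edge n) → Fin n → Fin n → Bool
connected {n} G u v = conn G n u v

delete : ∀ {n} → Edge n → List (Edge n) → List (Edge n)
delete e G = boolFilter (λ f → not (f ==ₑ e)) G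

-- G is a forest (acyclic): no edge {u,v} of G lies on a cycle, i.e. u and v
-- are not joined by a path in G minus that edge.
isForest : ∀ {n} → List (Edge n) → Bool
isForest G = all (λ e → not (connected (delete e G) (proj₁ e) (proj₂ e))) G

forests : (n : ℕ) → List (List (Edge n))
forests n = boolFilter isForest (allGraphs n)

-- Components: each connected component T ∈ c(F) is represented by its
-- least vertex r (the "root"): r is a root iff no vertex u < r lies in its component.
isRoot : ∀ {n} → List (Edge n) → Fin n → Bool
isRoot {n} G r = not (any (λ u → (toℕ u <ᵇ toℕ r) ∧ connected G u r) (allFin n))

roots : ∀ {n} → List (Edge n) → List (Fin n)
roots {n} G = boolFilter (isRoot G) (allFin n)

numComponents : ∀ {n} → List (Edge n) → ℕ
numComponents G = length (roots G)

forestsWith : (n i : ℕ) → List (List (Edge n))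
forestsWith n i = boolFilter (λ F → numComponents F ≡ᵇ i) (forests n)

compWeight : ∀ {n} → (Fin n → ℕ) → List (Edge n) → Fin n → ℕ
compWeight {n} w G r = sum (map w (boolFilter (λ j → connected G r j) (allFin n)))

degree : ∀ {n} → List (Edge n) → Fin n → ℕ
degree G v = length (boolFilter (λ e → (proj₁ e ==ᶠ v) ∨ (proj₂ e ==ᶠ v)) G)

mass : ∀ {n} → (Fin n → ℕ) → List (Edge n) → ℕ
mass {n} w F = product (map (λ i → w i ^ degree F i) (allFin n))

Kconst : ∀ {n} → (Fin n → ℕ) → ℕ
Kconst {n} w = sum (map (mass w) (forests n))

-- Σ over unordered pairs {T,T'} of distinct components of w(T) w(T')
-- (pairs of roots r < r')
pairSum : ∀ {n} → (Fin n → ℕ) → List (Edge n) → ℕ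
pairSum w F =
  sum (concatMap (λ r → map (λ r' → compWeight w F r * compWeight w F r')
                            (boolFilter (λ r' → toℕ r <ᵇ toℕ r') (roots F)))
                 (roots F))

-- F' is obtained from F by adding one edge: there is a potential edge e ∉ F
-- such that the edge set of F' is exactly that of F together with e.
addsEdge : ∀ {n} → List (Edge n) → List (Edge n) → Bool
addsEdge {n} F' F =
  any (λ e → not (e ∈ₑ F) ∧
             all (λ x → (x ∈ₑ F') ∧ ((x ==ₑ e) ∨ (x ∈ₑ F))
                        ∨ not (x ∈ₑ F') ∧ not ((x ==ₑ e) ∨ (x ∈ₑ F)))
                 (allEdges n))
      (allEdges n)

-- division of naturals into ℚ, with x / 0 := 0 (never used with 0 below
-- under the hypotheses of the lemma)
_÷_ : ℕ → ℕ → ℚ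
x ÷ zero = 0ℚ
x ÷ suc d = (+ x) / suc d

φ : ∀ {n} → (Fin n → ℕ) → List (Edge n) → List (Edge n) → ℚ
φ w F' F = if addsEdge F' F then mass w F' ÷ pairSum w F else 0ℚ

sumℚ : List ℚ → ℚ
sumℚ = foldr _+ℚ_ 0ℚ

probOf : ∀ {n} → (Fin n → ℕ) → List (Edge n) → ℚ
probOf w F = mass w F ÷ Kconst w

-- P(𝐅 ∈ A) for a set A of forests given as a (duplicate-free) list
probIn : ∀ {n} → (Fin n → ℕ) → List (List (Edge n)) → ℚ
probIn w A = sumℚ (map (probOf w) A)

module Submission where

-- The theorem says that for a forest F with i + 1 components, the forests F'
-- with i components obtained from F by adding one edge have total mass
-- mass(F) · Σ_{T ≠ T'} w(T) w(T'), the denominator of φ(F',F).  Indeed each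
-- such F' is F + uv for a unique potential edge uv joining two components,
-- and mass(F + uv) = mass(F) · w_u w_v; the products w_u w_v over such edges
-- add up to the sum over pairs of components of w(T) w(T').  Hence
-- Σ_{F'} φ(F',F) = mass(F), and summing over F ∈ 𝓕_{n,i+1} gives the first
-- equation; the second holds for every set of forests because K ≥ 1.

module BooleanReflection where

  open import Defs
  open import Data.Nat using (ℕ; suc; _+_; _*_; _≤_; _<_; z≤n; s≤s; _<ᵇ_; _≡ᵇ_)
  open import Data.Nat.Properties using (<ᵇ⇒<; <⇒<ᵇ; ≡ᵇ⇒≡; ≡⇒≡ᵇ; +-identityʳ)
  open import Data.Fin using (Fin) renaming (suc to fs)
  open import Data.Fin.Properties using (suc-injective) renaming (_≟_ to _≟ᶠ_)
  open import Data.Bool using (Bool; true; false; _∧_; _∨_; not)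
  open import Data.Bool.Properties using (∨-zeroʳ; T-≡)
  open import Data.Bool.ListAction using (any; all)
  open import Data.List using (List; []; _∷_)
  open import Data.List.Membership.Propositional using (_∈_)
  open import Data.List.Relation.Unary.Any using (here; there)
  open import Data.Product using (_×_; _,_; Σ; proj₁; proj₂)
  open import Data.Sum using (_⊎_; inj₁; inj₂)
  open import Data.Empty using (⊥; ⊥-elim)
  open import Function.Bundles using (Equivalence)
  open import Relation.Nullary using (¬_; yes; no)
  open import Relation.Binary.PropositionalEquality

  true≢false : true ≡ false → ⊥
  true≢false ()

  ≢true⇒false : ∀ {a} → ¬ (a ≡ true) → a ≡ false
  ≢true⇒false {true} h = ⊥-elim (h refl)
  ≢true⇒false {false} h = refl

  ∨-true : ∀ {a b} → (a ∨ b) ≡ true → (a ≡ true) ⊎ (b ≡ true)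
  ∨-true {true} h = inj₁ refl
  ∨-true {false} h = inj₂ h

  ∧-true : ∀ {a b} → (a ∧ b) ≡ true → (a ≡ true) × (b ≡ true)
  ∧-true {true} h = refl , h

  not-true : ∀ {a} → not a ≡ true → a ≡ false
  not-true {false} h = refl

  bool-ext : ∀ {a b : Bool} → (a ≡ true → b ≡ true) → (b ≡ true → a ≡ true) → a ≡ b
  bool-ext {true} to from = sym (to refl)
  bool-ext {false} {true} to from = from refl
  bool-ext {false} {false} to from = refl

  -- The Iverson bracket turns a boolean into the number 0 or 1, so that
  -- counting and restricted sums become ordinary sums.
  𝟙 : Bool → ℕ
  𝟙 true = 1
  𝟙 false = 0

  𝟙≤1 : ∀ b → 𝟙 b ≤ 1
  𝟙≤1 true = s≤s z≤n
  𝟙≤1 false = z≤n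

  𝟙-∧ : ∀ a b → 𝟙 (a ∧ b) ≡ 𝟙 a * 𝟙 b
  𝟙-∧ true b = sym (+-identityʳ (𝟙 b))
  𝟙-∧ false b = refl

  𝟙-mono : ∀ {a b} → (a ≡ true → b ≡ true) → 𝟙 a ≤ 𝟙 b
  𝟙-mono {false} imp = z≤n
  𝟙-mono {true} imp rewrite imp refl = s≤s z≤n

  𝟙-mono-< : ∀ {a b} → (a ≡ true → b ≡ true) → ¬ b ≡ a → 𝟙 a < 𝟙 b
  𝟙-mono-< {true} imp ne = ⊥-elim (ne (imp refl))
  𝟙-mono-< {false} {true} imp ne = s≤s z≤n
  𝟙-mono-< {false} {false} imp ne = ⊥-elim (ne refl)

  𝟙-∨-disjoint : ∀ a b → ¬ ((a ≡ true) × (b ≡ true)) → 𝟙 (a ∨ b) ≡ 𝟙 a + 𝟙 b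
  𝟙-∨-disjoint true true h = ⊥-elim (h (refl , refl))
  𝟙-∨-disjoint true false h = refl
  𝟙-∨-disjoint false b h = refl

  <ᵇ-true : ∀ {m n} → (m <ᵇ n) ≡ true → m < n
  <ᵇ-true {m} {n} h = <ᵇ⇒< m n (Equivalence.from T-≡ h)

  <ᵇ-intro : ∀ {m n} → m < n → (m <ᵇ n) ≡ true
  <ᵇ-intro lt = Equivalence.to T-≡ (<⇒<ᵇ lt)

  <ᵇ-false : ∀ {m n} → ¬ m < n → (m <ᵇ n) ≡ false
  <ᵇ-false ne = ≢true⇒false (λ h → ne (<ᵇ-true h))

  ≡ᵇ-true : ∀ {m n} → (m ≡ᵇ n) ≡ true → m ≡ n
  ≡ᵇ-true {m} {n} h = ≡ᵇ⇒≡ m n (Equivalence.from T-≡ h)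

  ≡ᵇ-intro : ∀ {m n} → m ≡ n → (m ≡ᵇ n) ≡ true
  ≡ᵇ-intro {m} refl = Equivalence.to T-≡ (≡⇒≡ᵇ m m refl)

  positive⇒suc : ∀ {m} → 1 ≤ m → Σ ℕ λ p → m ≡ suc p
  positive⇒suc {suc p} _ = p , refl

  ==ᶠ-true : ∀ {n} {a b : Fin n} → (a ==ᶠ b) ≡ true → a ≡ b
  ==ᶠ-true {a = a} {b} h with a ≟ᶠ b
  ... | yes e = e

  ==ᶠ-refl : ∀ {n} (a : Fin n) → (a ==ᶠ a) ≡ true
  ==ᶠ-refl a with a ≟ᶠ a
  ... | yes _ = refl
  ... | no ne = ⊥-elim (ne refl)

  ==ᶠ-intro : ∀ {n} {a b : Fin n} → a ≡ b → (a ==ᶠ b) ≡ true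
  ==ᶠ-intro {a = a} refl = ==ᶠ-refl a

  ==ᶠ-false : ∀ {n} {a b : Fin n} → (a ==ᶠ b) ≡ false → ¬ a ≡ b
  ==ᶠ-false {a = a} h refl = true≢false (trans (sym (==ᶠ-refl a)) h)

  ==ᶠ-suc : ∀ {n} (a b : Fin n) → (fs a ==ᶠ fs b) ≡ (a ==ᶠ b)
  ==ᶠ-suc a b = bool-ext (λ h → ==ᶠ-intro (suc-injective (==ᶠ-true h)))
                         (λ h → ==ᶠ-intro (cong fs (==ᶠ-true h)))

  module _ {A : Set} where

    any-true : ∀ (p : A → Bool) L → any p L ≡ true → Σ A λ x → x ∈ L × p x ≡ true
    any-true p (x ∷ L) h with p x in eq
    ... | true = x , here refl , eq
    ... | false with any-true p L h
    ... | y , m , e = y , there m , e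

    any-intro : ∀ (p : A → Bool) L {x} → x ∈ L → p x ≡ true → any p L ≡ true
    any-intro p (y ∷ L) (here refl) e rewrite e = refl
    any-intro p (y ∷ L) (there m) e rewrite any-intro p L m e = ∨-zeroʳ (p y)

    any-none : ∀ (p : A → Bool) L → (∀ x → x ∈ L → p x ≡ false) → any p L ≡ false
    any-none p [] h = refl
    any-none p (y ∷ L) h rewrite h y (here refl) = any-none p L (λ x m → h x (there m))

    any-cong : ∀ {p q : A → Bool} L → (∀ x → p x ≡ q x) → any p L ≡ any q L
    any-cong [] h = refl
    any-cong (x ∷ L) h = cong₂ _∨_ (h x) (any-cong L h)

    all-true : ∀ (p : A → Bool) L → all p L ≡ true → ∀ {x} → x ∈ L → p x ≡ true
    all-true p (y ∷ L) h (here refl) = proj₁ (∧-true h)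
    all-true p (y ∷ L) h (there m) = all-true p L (proj₂ (∧-true h)) m

    all-intro : ∀ (p : A → Bool) L → (∀ x → x ∈ L → p x ≡ true) → all p L ≡ true
    all-intro p [] h = refl
    all-intro p (y ∷ L) h rewrite h y (here refl) = all-intro p L (λ x m → h x (there m))

    all-false : ∀ (p : A → Bool) L {x} → x ∈ L → p x ≡ false → all p L ≡ false
    all-false p L m hp = ≢true⇒false (λ h → true≢false (trans (sym (all-true p L h m)) hp))

  module _ {A : Set} (p : A → Bool) where

    filter-⊆ : ∀ L {y} → y ∈ boolFilter p L → y ∈ L
    filter-⊆ (x ∷ L) m with p x
    ... | false = there (filter-⊆ L m)
    ... | true with m
    ...   | here e = here e
    ...   | there m' = there (filter-⊆ L m')

    filter-prop : ∀ L {y} → y ∈ boolFilter p L → p y ≡ true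
    filter-prop (x ∷ L) m with p x in eq
    ... | false = filter-prop L m
    ... | true with m
    ...   | here refl = eq
    ...   | there m' = filter-prop L m'

    filter-∈ : ∀ L {y} → y ∈ L → p y ≡ true → y ∈ boolFilter p L
    filter-∈ (x ∷ L) (here refl) e rewrite e = here refl
    filter-∈ (x ∷ L) (there m) e with p x
    ... | true = there (filter-∈ L m e)
    ... | false = filter-∈ L m e

  filter-cong : ∀ {A : Set} (L : List A) {p q : A → Bool} → (∀ x → x ∈ L → p x ≡ q x) →
                boolFilter p L ≡ boolFilter q L
  filter-cong [] h = refl
  filter-cong (x ∷ L) {p} {q} h rewrite h x (here refl) | filter-cong L {p} {q} (λ y m → h y (there m)) = refl

module FiniteSums where

  open import Defs using (boolFilter; _==ᶠ_)
  open BooleanReflection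
  open import Data.Nat using (ℕ; zero; suc; _+_; _*_; _^_; _≤_; _<_; z≤n)
  open import Data.Nat.Properties
  open import Data.Fin using (Fin) renaming (zero to fz; suc to fs)
  open import Data.Bool using (true; false)
  open import Data.List using (List; []; _∷_; _++_; map; allFin; concatMap; length; tabulate)
  open import Data.List.Membership.Propositional using (_∈_)
  open import Data.List.Relation.Unary.Any using (here; there)
  open import Data.Nat.ListAction using (sum; product)
  open import Algebra.Properties.CommutativeSemigroup +-commutativeSemigroup
    using () renaming (interchange to +-interchange)
  open import Algebra.Properties.CommutativeSemigroup *-commutativeSemigroup
    using () renaming (interchange to *-interchange)
  open import Function using (_∘_)
  open import Relation.Binary.PropositionalEquality

  -- They
  -- agree with the library's sum (map f L) and product (map f L), but keep
  -- the summand visible as a function, which is what the algebra below needs.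
  ∑ : ∀ {A : Set} → List A → (A → ℕ) → ℕ
  ∑ [] f = 0
  ∑ (x ∷ xs) f = f x + ∑ xs f

  ∏ : ∀ {A : Set} → List A → (A → ℕ) → ℕ
  ∏ [] f = 1
  ∏ (x ∷ xs) f = f x * ∏ xs f

  module _ {A : Set} where

    sum-map : ∀ (L : List A) f → sum (map f L) ≡ ∑ L f
    sum-map [] f = refl
    sum-map (x ∷ L) f = cong (f x +_) (sum-map L f)

    product-map : ∀ (L : List A) f → product (map f L) ≡ ∏ L f
    product-map [] f = refl
    product-map (x ∷ L) f = cong (f x *_) (product-map L f)

    ∑-cong : ∀ (L : List A) {f g} → (∀ x → x ∈ L → f x ≡ g x) → ∑ L f ≡ ∑ L g
    ∑-cong [] h = refl
    ∑-cong (x ∷ L) h = cong₂ _+_ (h x (here refl)) (∑-cong L (λ y m → h y (there m)))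

    ∑-cong' : ∀ (L : List A) {f g} → (∀ x → f x ≡ g x) → ∑ L f ≡ ∑ L g
    ∑-cong' L h = ∑-cong L (λ x _ → h x)

    ∏-cong : ∀ (L : List A) {f g} → (∀ x → f x ≡ g x) → ∏ L f ≡ ∏ L g
    ∏-cong [] h = refl
    ∏-cong (x ∷ L) h = cong₂ _*_ (h x) (∏-cong L h)

    ∑-zero : ∀ (L : List A) f → (∀ x → x ∈ L → f x ≡ 0) → ∑ L f ≡ 0
    ∑-zero [] f h = refl
    ∑-zero (x ∷ L) f h = cong₂ _+_ (h x (here refl)) (∑-zero L f (λ y m → h y (there m)))

    ∑-+ : ∀ (L : List A) f g → ∑ L (λ x → f x + g x) ≡ ∑ L f + ∑ L g
    ∑-+ [] f g = refl
    ∑-+ (x ∷ L) f g rewrite ∑-+ L f g = +-interchange (f x) (g x) (∑ L f) (∑ L g)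

    ∏-* : ∀ (L : List A) f g → ∏ L (λ x → f x * g x) ≡ ∏ L f * ∏ L g
    ∏-* [] f g = refl
    ∏-* (x ∷ L) f g rewrite ∏-* L f g = *-interchange (f x) (g x) (∏ L f) (∏ L g)

    ∑-*ˡ : ∀ (L : List A) c f → ∑ L (λ x → c * f x) ≡ c * ∑ L f
    ∑-*ˡ [] c f = sym (*-zeroʳ c)
    ∑-*ˡ (x ∷ L) c f rewrite ∑-*ˡ L c f = sym (*-distribˡ-+ c (f x) (∑ L f))

    ∑-*ʳ : ∀ (L : List A) c f → ∑ L (λ x → f x * c) ≡ ∑ L f * c
    ∑-*ʳ L c f = trans (∑-cong' L (λ x → *-comm (f x) c)) (trans (∑-*ˡ L c f) (*-comm c (∑ L f)))

    ∑-++ : ∀ (xs ys : List A) f → ∑ (xs ++ ys) f ≡ ∑ xs f + ∑ ys f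
    ∑-++ [] ys f = refl
    ∑-++ (x ∷ xs) ys f rewrite ∑-++ xs ys f = sym (+-assoc (f x) (∑ xs f) (∑ ys f))

    ∑-filter : ∀ (L : List A) p f → ∑ (boolFilter p L) f ≡ ∑ L (λ x → 𝟙 (p x) * f x)
    ∑-filter [] p f = refl
    ∑-filter (x ∷ L) p f with p x
    ... | true = cong₂ _+_ (sym (+-identityʳ (f x))) (∑-filter L p f)
    ... | false = ∑-filter L p f

    length-filter : ∀ (L : List A) p → length (boolFilter p L) ≡ ∑ L (λ x → 𝟙 (p x))
    length-filter [] p = refl
    length-filter (x ∷ L) p with p x
    ... | true = cong suc (length-filter L p)
    ... | false = length-filter L p

    ∑-mono : ∀ (L : List A) {f g} → (∀ x → f x ≤ g x) → ∑ L f ≤ ∑ L g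
    ∑-mono [] h = z≤n
    ∑-mono (x ∷ L) h = +-mono-≤ (h x) (∑-mono L h)

    term≤∑ : ∀ (L : List A) f {x} → x ∈ L → f x ≤ ∑ L f
    term≤∑ (y ∷ L) f (here refl) = m≤m+n (f y) (∑ L f)
    term≤∑ (y ∷ L) f (there m) = ≤-trans (term≤∑ L f m) (m≤n+m (∑ L f) (f y))

    ∑-mono-< : ∀ (L : List A) {f g} → (∀ x → f x ≤ g x) → ∀ {x} → x ∈ L → f x < g x → ∑ L f < ∑ L g
    ∑-mono-< (y ∷ L) h (here refl) lt = +-mono-<-≤ lt (∑-mono L h)
    ∑-mono-< (y ∷ L) h (there m) lt = +-mono-≤-< (h y) (∑-mono-< L h m lt)

  module _ {A B : Set} where

    ∑-map : ∀ (L : List A) (g : A → B) f → ∑ (map g L) f ≡ ∑ L (f ∘ g)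
    ∑-map [] g f = refl
    ∑-map (x ∷ L) g f = cong (f (g x) +_) (∑-map L g f)

    ∑-concatMap : ∀ (L : List A) (h : A → List B) f → ∑ (concatMap h L) f ≡ ∑ L (λ x → ∑ (h x) f)
    ∑-concatMap [] h f = refl
    ∑-concatMap (x ∷ L) h f = trans (∑-++ (h x) (concatMap h L) f) (cong (∑ (h x) f +_) (∑-concatMap L h f))

    ∑-swap : ∀ (L : List A) (M : List B) (f : A → B → ℕ) →
             ∑ L (λ a → ∑ M (f a)) ≡ ∑ M (λ b → ∑ L (λ a → f a b))
    ∑-swap [] M f = sym (∑-zero M _ (λ _ _ → refl))
    ∑-swap (x ∷ L) M f =
      trans (cong (∑ M (f x) +_) (∑-swap L M f)) (sym (∑-+ M (f x) (λ b → ∑ L (λ a → f a b))))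

  ∑-allFin-suc : ∀ n (f : Fin (suc n) → ℕ) → ∑ (allFin (suc n)) f ≡ f fz + ∑ (allFin n) (f ∘ fs)
  ∑-allFin-suc n f = cong (f fz +_) (∑-tabulate n fs f)
    where
    ∑-tabulate : ∀ {A : Set} m (g : Fin m → A) h → ∑ (tabulate g) h ≡ ∑ (allFin m) (h ∘ g)
    ∑-tabulate zero g h = refl
    ∑-tabulate (suc m) g h =
      cong (h (g fz) +_) (trans (∑-tabulate m (g ∘ fs) h) (sym (∑-tabulate m fs (h ∘ g))))

  ∏-allFin-suc : ∀ n (f : Fin (suc n) → ℕ) → ∏ (allFin (suc n)) f ≡ f fz * ∏ (allFin n) (f ∘ fs)
  ∏-allFin-suc n f = cong (f fz *_) (∏-tabulate n fs f)
    where
    ∏-tabulate : ∀ {A : Set} m (g : Fin m → A) h → ∏ (tabulate g) h ≡ ∏ (allFin m) (h ∘ g)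
    ∏-tabulate zero g h = refl
    ∏-tabulate (suc m) g h =
      cong (h (g fz) *_) (trans (∏-tabulate m (g ∘ fs) h) (sym (∏-tabulate m fs (h ∘ g))))

  ∈-allFin : ∀ {n} (k : Fin n) → k ∈ allFin n
  ∈-allFin = Data.List.Membership.Propositional.Properties.∈-allFin
    where import Data.List.Membership.Propositional.Properties

  ∑-allFin-1 : ∀ n → ∑ (allFin n) (λ _ → 1) ≡ n
  ∑-allFin-1 zero = refl
  ∑-allFin-1 (suc n) = trans (∑-allFin-suc n (λ _ → 1)) (cong suc (∑-allFin-1 n))

  ∑-delta : ∀ {n} (a : Fin n) (g : Fin n → ℕ) → ∑ (allFin n) (λ x → 𝟙 (x ==ᶠ a) * g x) ≡ g a
  ∑-delta {suc n} fz g =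
    trans (∑-allFin-suc n (λ x → 𝟙 (x ==ᶠ fz) * g x))
          (trans (cong₂ _+_ (+-identityʳ (g fz)) (∑-zero (allFin n) _ (λ _ _ → refl))) (+-identityʳ _))
  ∑-delta {suc n} (fs a) g =
    trans (∑-allFin-suc n (λ x → 𝟙 (x ==ᶠ fs a) * g x))
          (trans (∑-cong' (allFin n) (λ x → cong (λ b → 𝟙 b * g (fs x)) (==ᶠ-suc x a)))
                 (∑-delta a (g ∘ fs)))

  ∏-delta : ∀ {n} (a : Fin n) (g : Fin n → ℕ) → ∏ (allFin n) (λ x → g x ^ 𝟙 (a ==ᶠ x)) ≡ g a
  ∏-delta {suc n} fz g =
    trans (∏-allFin-suc n (λ x → g x ^ 𝟙 (fz ==ᶠ x))) (trans (cong₂ _*_ (*-identityʳ (g fz)) (∏-ones (allFin n))) (*-identityʳ _))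
    where
    ∏-ones : ∀ (L : List (Fin n)) → ∏ L (λ x → g (fs x) ^ 𝟙 (fz ==ᶠ fs x)) ≡ 1
    ∏-ones [] = refl
    ∏-ones (x ∷ L) = cong (1 *_) (∏-ones L)
  ∏-delta {suc n} (fs a) g =
    trans (∏-allFin-suc n (λ x → g x ^ 𝟙 (fs a ==ᶠ x)))
          (trans (+-identityʳ _)
                 (trans (∏-cong (allFin n) (λ x → cong (λ b → g (fs x) ^ 𝟙 b) (==ᶠ-suc a x)))
                        (∏-delta a (g ∘ fs))))

module Reachability where

  open import Defs
  open BooleanReflection
  open FiniteSums
  open import Data.Nat using (ℕ; zero; suc; _+_; _∸_; _≤_; _<_; s≤s)
  open import Data.Nat.Properties
  open import Data.Fin using (Fin)
  open import Data.Fin.Properties using (all?; ¬∀⟶∃¬)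
  open import Data.Bool using (Bool; true; false; _∧_; _∨_)
  open import Data.Bool.Properties using (∨-zeroʳ) renaming (_≟_ to _≟ᵇ_)
  open import Data.Bool.ListAction using (any)
  open import Data.List using (List; allFin)
  open import Data.List.Membership.Propositional using (_∈_)
  open import Data.Product using (_×_; _,_; proj₁; proj₂; Σ)
  open import Data.Sum using (_⊎_; inj₁; inj₂)
  open import Data.Empty using (⊥-elim)
  open import Relation.Nullary using (¬_; yes; no)
  open import Relation.Binary.PropositionalEquality

  -- Reach G u v: v is reachable from u along edges of G, each edge usable in
  -- either direction.  This is the inductive counterpart of Defs.connected.
  data Reach {n} (G : List (Edge n)) (u : Fin n) : Fin n → Set where
    here : Reach G u u
    forward : ∀ {a b} → Reach G u a → (a , b) ∈ G → Reach G u b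
    backward : ∀ {a b} → Reach G u b → (a , b) ∈ G → Reach G u a

  module _ {n} {G : List (Edge n)} where

    Reach-trans : ∀ {u v w} → Reach G u v → Reach G v w → Reach G u w
    Reach-trans p here = p
    Reach-trans p (forward q e) = forward (Reach-trans p q) e
    Reach-trans p (backward q e) = backward (Reach-trans p q) e

    Reach-edge : ∀ {a b} → (a , b) ∈ G → Reach G a b
    Reach-edge e = forward here e

    Reach-sym : ∀ {u v} → Reach G u v → Reach G v u
    Reach-sym here = here
    Reach-sym (forward p e) = Reach-trans (backward here e) (Reach-sym p)
    Reach-sym (backward p e) = Reach-trans (forward here e) (Reach-sym p)

  Reach-mono : ∀ {n} {G G' : List (Edge n)} → (∀ e → e ∈ G → e ∈ G') →
               ∀ {u v} → Reach G u v → Reach G' u v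
  Reach-mono sub here = here
  Reach-mono sub (forward p e) = forward (Reach-mono sub p) (sub _ e)
  Reach-mono sub (backward p e) = backward (Reach-mono sub p) (sub _ e)

  -- It is sound, every reachable vertex is found for some
  -- k, and the search stabilises after fewer than n rounds: as long as it has
  -- not stabilised, each round finds a new vertex, and there are only n.
  module BoundedSearch {n} (G : List (Edge n)) (u : Fin n) where

    found : ℕ → Fin n → Bool
    found k v = conn G k u v

    round : (Fin n → Bool) → Fin n → Bool
    round f v = f v ∨ any (λ e → (f (proj₁ e) ∧ (proj₂ e ==ᶠ v)) ∨ (f (proj₂ e) ∧ (proj₁ e ==ᶠ v))) G

    round-cong : ∀ {f g} → (∀ v → f v ≡ g v) → ∀ v → round f v ≡ round g v
    round-cong h v =
      cong₂ _∨_ (h v) (any-cong G (λ e → cong₂ _∨_ (cong (_∧ _) (h (proj₁ e))) (cong (_∧ _) (h (proj₂ e)))))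

    sound : ∀ k {v} → found k v ≡ true → Reach G u v
    sound zero h rewrite ==ᶠ-true h = here
    sound (suc k) {v} h with ∨-true {found k v} h
    ... | inj₁ old = sound k old
    ... | inj₂ new with any-true _ G new
    ...   | (a , b) , m , step with ∨-true {found k a ∧ (b ==ᶠ v)} step
    ...     | inj₁ fw = subst (Reach G u) (==ᶠ-true (proj₂ (∧-true fw))) (forward (sound k (proj₁ (∧-true fw))) m)
    ...     | inj₂ bw = subst (Reach G u) (==ᶠ-true (proj₂ (∧-true bw))) (backward (sound k (proj₁ (∧-true bw))) m)

    complete : ∀ {v} → Reach G u v → Σ ℕ λ k → found k v ≡ true
    complete here = zero , ==ᶠ-refl u
    complete (forward {a} {b} p m) with complete p
    ... | k , h = suc k , trans (cong (found k b ∨_) (any-intro _ G m hit)) (∨-zeroʳ _)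
      where
      hit : ((found k a ∧ (b ==ᶠ b)) ∨ (found k b ∧ (a ==ᶠ b))) ≡ true
      hit rewrite h | ==ᶠ-refl b = refl
    complete (backward {a} {b} p m) with complete p
    ... | k , h = suc k , trans (cong (found k a ∨_) (any-intro _ G m hit)) (∨-zeroʳ _)
      where
      hit : ((found k a ∧ (b ==ᶠ a)) ∨ (found k b ∧ (a ==ᶠ a))) ≡ true
      hit rewrite h | ==ᶠ-refl a = ∨-zeroʳ _

    found-mono : ∀ {k k'} → k ≤ k' → ∀ {v} → found k v ≡ true → found k' v ≡ true
    found-mono {k} {k'} le h = subst (λ j → found j _ ≡ true) (m∸n+n≡m le) (more (k' ∸ k) h)
      where
      more : ∀ d {v} → found k v ≡ true → found (d + k) v ≡ true
      more zero h = h
      more (suc d) {v} h rewrite more d h = refl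

    Stable : ℕ → Set
    Stable k = ∀ v → found (suc k) v ≡ found k v

    stable-forever : ∀ k → Stable k → ∀ m v → found (m + k) v ≡ found k v
    stable-forever k st zero v = refl
    stable-forever k st (suc m) v = trans (round-cong (stable-forever k st m) v) (st v)

    #found : ℕ → ℕ
    #found k = ∑ (allFin n) (λ v → 𝟙 (found k v))

    #found≤n : ∀ k → #found k ≤ n
    #found≤n k = ≤-trans (∑-mono (allFin n) (λ v → 𝟙≤1 (found k v))) (≤-reflexive (∑-allFin-1 n))

    unstable-grows : ∀ k → ¬ Stable k → #found k < #found (suc k)
    unstable-grows k nst with ¬∀⟶∃¬ n _ (λ v → found (suc k) v ≟ᵇ found k v) nst
    ... | v , changed =
      ∑-mono-< (allFin n) (λ _ → 𝟙-mono (found-mono (n≤1+n k))) (∈-allFin v)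
               (𝟙-mono-< (found-mono (n≤1+n k)) changed)

    stable-or-large : ∀ k → (Σ ℕ λ j → j < k × Stable j) ⊎ (suc k ≤ #found k)
    stable-or-large zero =
      inj₂ (≤-trans (≤-reflexive (cong 𝟙 (sym (==ᶠ-refl u)))) (term≤∑ (allFin n) _ (∈-allFin u)))
    stable-or-large (suc k) with stable-or-large k
    ... | inj₁ (j , j<k , st) = inj₁ (j , ≤-trans j<k (n≤1+n _) , st)
    ... | inj₂ large with all? (λ v → found (suc k) v ≟ᵇ found k v)
    ...   | yes st = inj₁ (k , ≤-refl , st)
    ...   | no nst = inj₂ (≤-trans (s≤s large) (unstable-grows k nst))

    stabilises : Σ ℕ λ j → j < n × Stable j
    stabilises with stable-or-large n
    ... | inj₁ r = r
    ... | inj₂ large = ⊥-elim (<-irrefl refl (≤-trans large (#found≤n n)))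

    found-by-n : ∀ k {v} → found k v ≡ true → found n v ≡ true
    found-by-n k {v} h with stabilises
    ... | j , j<n , st =
      found-mono (<⇒≤ j<n) (trans (sym (stable-forever j st k v)) (found-mono (m≤m+n k j) h))

  connected⇒Reach : ∀ {n} (G : List (Edge n)) {u v} → connected G u v ≡ true → Reach G u v
  connected⇒Reach {n} G h = BoundedSearch.sound G _ n h

  Reach⇒connected : ∀ {n} (G : List (Edge n)) {u v} → Reach G u v → connected G u v ≡ true
  Reach⇒connected G {u} p with BoundedSearch.complete G u p
  ... | k , h = BoundedSearch.found-by-n G u k h

  ¬Reach⇒disconnected : ∀ {n} (G : List (Edge n)) {u v} → ¬ Reach G u v → connected G u v ≡ false
  ¬Reach⇒disconnected G np = ≢true⇒false (λ h → np (connected⇒Reach G h))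

  disconnected⇒¬Reach : ∀ {n} (G : List (Edge n)) {u v} → connected G u v ≡ false → ¬ Reach G u v
  disconnected⇒¬Reach G h p = true≢false (trans (sym (Reach⇒connected G p)) h)

module Components where

  open import Defs
  open BooleanReflection
  open FiniteSums
  open Reachability
  open import Data.Nat using (ℕ; suc; _+_; _*_; _≤_; _<_; z≤n; _<ᵇ_)
  open import Data.Nat.Properties
  open import Data.Fin using (Fin; toℕ)
  open import Data.Fin.Properties using (toℕ-injective)
  open import Data.Bool using (Bool; true; false; _∧_; _∨_; not)
  open import Data.Bool.Properties using (not-involutive; ∧-identityʳ; ∨-zeroʳ; ∨-comm)
  open import Data.Bool.ListAction using (any)
  open import Data.List using (List; allFin)
  open import Data.Product using (_×_; _,_; proj₁; proj₂; Σ)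
  open import Data.Sum using (inj₁; inj₂)
  open import Data.Empty using (⊥; ⊥-elim)
  open import Relation.Binary.PropositionalEquality
  open import Relation.Binary.Definitions using (tri<; tri≈; tri>)

  record BoolEquivalence (n : ℕ) : Set where
    field
      _~_ : Fin n → Fin n → Bool
      ~-refl : ∀ x → (x ~ x) ≡ true
      ~-sym : ∀ {x y} → (x ~ y) ≡ true → (y ~ x) ≡ true
      ~-trans : ∀ {x y z} → (x ~ y) ≡ true → (y ~ z) ≡ true → (x ~ z) ≡ true

  sameComponent : ∀ {n} → List (Edge n) → BoolEquivalence n
  sameComponent G = record
    { _~_ = connected G
    ; ~-refl = λ x → Reach⇒connected G here
    ; ~-sym = λ h → Reach⇒connected G (Reach-sym (connected⇒Reach G h))
    ; ~-trans = λ h₁ h₂ → Reach⇒connected G (Reach-trans (connected⇒Reach G h₁) (connected⇒Reach G h₂))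
    }

  -- For the relation
  -- sameComponent G, isRoot and numComponents of Defs are exactly isRootOf and
  -- #roots below, so these are the components of the graph.
  module Roots {n : ℕ} (E : BoolEquivalence n) where

    open BoolEquivalence E

    isRootOf : Fin n → Bool
    isRootOf r = not (any (λ u → (toℕ u <ᵇ toℕ r) ∧ (u ~ r)) (allFin n))

    #roots : ℕ
    #roots = ∑ (allFin n) (λ r → 𝟙 (isRootOf r))

    root-minimal : ∀ {r} → isRootOf r ≡ true → ∀ u → toℕ u < toℕ r → (u ~ r) ≡ false
    root-minimal h u u<r =
      ≢true⇒false (λ e → true≢false
        (trans (sym (any-intro _ (allFin n) (∈-allFin u) (cong₂ _∧_ (<ᵇ-intro u<r) e))) (not-true h)))

    minimal-root : ∀ {r} → (∀ u → toℕ u < toℕ r → (u ~ r) ≡ false) → isRootOf r ≡ true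
    minimal-root {r} h = cong not (any-none _ (allFin n) (λ u _ → smaller-inequivalent u))
      where
      smaller-inequivalent : ∀ u → ((toℕ u <ᵇ toℕ r) ∧ (u ~ r)) ≡ false
      smaller-inequivalent u with toℕ u <ᵇ toℕ r in eq
      ... | true = h u (<ᵇ-true eq)
      ... | false = refl

    non-root : ∀ {r} → isRootOf r ≡ false → Σ (Fin n) λ u → toℕ u < toℕ r × (u ~ r) ≡ true
    non-root h with any-true _ (allFin n) (trans (sym (not-involutive _)) (cong not h))
    ... | u , _ , e = u , <ᵇ-true (proj₁ (∧-true e)) , proj₂ (∧-true e)

    find-root : ∀ k x → toℕ x < k → Σ (Fin n) λ r → isRootOf r ≡ true × (r ~ x) ≡ true
    find-root (suc k) x x<k with isRootOf x in eq
    ... | true = x , eq , ~-refl x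
    ... | false with non-root eq
    ...   | u , u<x , u~x with find-root k u (≤-trans u<x (≤-pred x<k))
    ...     | r , root , r~u = r , root , ~-trans r~u u~x

    root-of : Fin n → Fin n
    root-of x = proj₁ (find-root (suc (toℕ x)) x ≤-refl)

    root-of-isRoot : ∀ x → isRootOf (root-of x) ≡ true
    root-of-isRoot x = proj₁ (proj₂ (find-root (suc (toℕ x)) x ≤-refl))

    root-of-~ : ∀ x → (root-of x ~ x) ≡ true
    root-of-~ x = proj₂ (proj₂ (find-root (suc (toℕ x)) x ≤-refl))

    roots-unique : ∀ {r r'} → isRootOf r ≡ true → isRootOf r' ≡ true → (r ~ r') ≡ true → r ≡ r'
    roots-unique {r} {r'} hr hr' r~r' with <-cmp (toℕ r) (toℕ r')
    ... | tri< lt _ _ = ⊥-elim (true≢false (trans (sym r~r') (root-minimal hr' r lt)))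
    ... | tri≈ _ eq _ = toℕ-injective eq
    ... | tri> _ _ gt = ⊥-elim (true≢false (trans (sym (~-sym r~r')) (root-minimal hr r' gt)))

    root-of-root : ∀ {r} → isRootOf r ≡ true → root-of r ≡ r
    root-of-root {r} h = roots-unique (root-of-isRoot r) h (root-of-~ r)

    ~⇒same-root : ∀ {a b} → (a ~ b) ≡ true → root-of a ≡ root-of b
    ~⇒same-root {a} {b} h =
      roots-unique (root-of-isRoot a) (root-of-isRoot b) (~-trans (~-trans (root-of-~ a) h) (~-sym (root-of-~ b)))

    same-root⇒~ : ∀ {a b} → root-of a ≡ root-of b → (a ~ b) ≡ true
    same-root⇒~ {a} {b} e = ~-trans (~-sym (root-of-~ a)) (subst (λ z → (z ~ b) ≡ true) (sym e) (root-of-~ b))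

    root-least : ∀ {r u} → isRootOf r ≡ true → (u ~ r) ≡ true → toℕ r ≤ toℕ u
    root-least {r} {u} hr u~r with <-cmp (toℕ u) (toℕ r)
    ... | tri< lt _ _ = ⊥-elim (true≢false (trans (sym u~r) (root-minimal hr u lt)))
    ... | tri≈ _ eq _ = ≤-reflexive (sym eq)
    ... | tri> _ _ gt = <⇒≤ gt

    ∑-root-of : ∀ x (f : Fin n → ℕ) → ∑ (allFin n) (λ r → 𝟙 (isRootOf r ∧ (r ~ x)) * f r) ≡ f (root-of x)
    ∑-root-of x f =
      trans (∑-cong' (allFin n) (λ r → cong (λ b → 𝟙 b * f r) (root-of-x r))) (∑-delta (root-of x) f)
      where
      root-of-x : ∀ r → (isRootOf r ∧ (r ~ x)) ≡ (r ==ᶠ root-of x)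
      root-of-x r = bool-ext
        (λ h → ==ᶠ-intro (roots-unique (proj₁ (∧-true h)) (root-of-isRoot x)
                                              (~-trans (proj₂ (∧-true h)) (~-sym (root-of-~ x)))))
        (λ h → subst (λ z → (isRootOf z ∧ (z ~ x)) ≡ true) (sym (==ᶠ-true h))
                     (cong₂ _∧_ (root-of-isRoot x) (root-of-~ x)))

    single-root : ∀ r₀ → (∀ r → isRootOf r ≡ true → r ≡ r₀) → #roots ≤ 1
    single-root r₀ only = ≤-trans (∑-mono (allFin n) at-most-r₀) (≤-reflexive (∑-delta r₀ (λ _ → 1)))
      where
      at-most-r₀ : ∀ r → 𝟙 (isRootOf r) ≤ 𝟙 (r ==ᶠ r₀) * 1
      at-most-r₀ r with isRootOf r in er
      ... | false = z≤n
      ... | true rewrite only r er | ==ᶠ-refl r₀ = ≤-refl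

  Merges : ∀ {n} → BoolEquivalence n → BoolEquivalence n → Fin n → Fin n → Set
  Merges E E' u v =
    ∀ a b → (a ~' b) ≡ ((a ~ b) ∨ (((a ~ u) ∧ (v ~ b)) ∨ ((a ~ v) ∧ (u ~ b))))
    where
    open BoolEquivalence E
    open BoolEquivalence E' renaming (_~_ to _~'_)

  Merges-sym : ∀ {n} {E E' : BoolEquivalence n} {u v} → Merges E E' u v → Merges E E' v u
  Merges-sym {E = E} {u = u} {v} joins a b =
    trans (joins a b) (cong ((a ~ b) ∨_) (∨-comm ((a ~ u) ∧ (v ~ b)) ((a ~ v) ∧ (u ~ b))))
    where open BoolEquivalence E

  -- Merging two classes whose roots are ru < rv: the roots of the merged
  -- relation are the old roots except rv.
  module MergeOrdered {n} (E E' : BoolEquivalence n) (u v : Fin n) (joins : Merges E E' u v) where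

    open BoolEquivalence E
    open BoolEquivalence E' using () renaming (_~_ to _~'_)
    open Roots E
    module R' = Roots E'

    ~⇒~' : ∀ {a b} → (a ~ b) ≡ true → (a ~' b) ≡ true
    ~⇒~' {a} {b} h rewrite joins a b | h = refl

    module _ (ru<rv : toℕ (root-of u) < toℕ (root-of v)) where

      old-root : ∀ {r} → R'.isRootOf r ≡ true → isRootOf r ≡ true
      old-root h' = minimal-root (λ x x<r → ≢true⇒false (λ x~r →
                      true≢false (trans (sym (~⇒~' x~r)) (R'.root-minimal h' x x<r))))

      rv-not-root : R'.isRootOf (root-of v) ≡ false
      rv-not-root = ≢true⇒false (λ h → true≢false (trans (sym ru~'rv) (R'.root-minimal h (root-of u) ru<rv)))
        where
        ru~'rv : (root-of u ~' root-of v) ≡ true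
        ru~'rv rewrite joins (root-of u) (root-of v) | root-of-~ u | ~-sym (root-of-~ v) = ∨-zeroʳ _

      other-root : ∀ {r} → isRootOf r ≡ true → (r ==ᶠ root-of v) ≡ false → R'.isRootOf r ≡ true
      other-root {r} root r≢rv = R'.minimal-root (λ x x<r → ≢true⇒false (impossible x x<r))
        where
        impossible : ∀ x → toℕ x < toℕ r → (x ~' r) ≡ true → ⊥
        impossible x x<r x~'r with ∨-true {x ~ r} (trans (sym (joins x r)) x~'r)
        ... | inj₁ x~r = true≢false (trans (sym x~r) (root-minimal root x x<r))
        ... | inj₂ across with ∨-true {(x ~ u) ∧ (v ~ r)} across
        ...   | inj₁ via-uv = ==ᶠ-false r≢rv (sym (trans (~⇒same-root (proj₂ (∧-true via-uv))) (root-of-root root)))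
        ...   | inj₂ via-vu = <-irrefl refl (begin-strict
                  toℕ (root-of v) ≤⟨ root-least (root-of-isRoot v) (~-trans (proj₁ (∧-true via-vu)) (~-sym (root-of-~ v))) ⟩
                  toℕ x           <⟨ x<r ⟩
                  toℕ r           ≡⟨ cong toℕ r≡ru ⟩
                  toℕ (root-of u) <⟨ ru<rv ⟩
                  toℕ (root-of v) ∎)
          where
          open ≤-Reasoning
          r≡ru : r ≡ root-of u
          r≡ru = sym (trans (~⇒same-root (proj₂ (∧-true via-vu))) (root-of-root root))

      new-roots : ∀ r → R'.isRootOf r ≡ (isRootOf r ∧ not (r ==ᶠ root-of v))
      new-roots r = bool-ext
        (λ h' → cong₂ _∧_ (old-root h') (cong not (not-rv h')))
        (λ h → other-root (proj₁ (∧-true h)) (not-true (proj₂ (∧-true h))))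
        where
        not-rv : R'.isRootOf r ≡ true → (r ==ᶠ root-of v) ≡ false
        not-rv h' = ≢true⇒false (λ e → true≢false (trans (sym h') (subst (λ z → R'.isRootOf z ≡ false) (sym (==ᶠ-true e)) rv-not-root)))

      ordered-count : #roots ≡ suc R'.#roots
      ordered-count = begin
        ∑ (allFin n) (λ r → 𝟙 (isRootOf r))
          ≡⟨ ∑-cong' (allFin n) split ⟩
        ∑ (allFin n) (λ r → 𝟙 (R'.isRootOf r) + 𝟙 (r ==ᶠ root-of v))
          ≡⟨ ∑-+ (allFin n) _ _ ⟩
        R'.#roots + ∑ (allFin n) (λ r → 𝟙 (r ==ᶠ root-of v))
          ≡⟨ cong (R'.#roots +_) count-rv ⟩
        R'.#roots + 1
          ≡⟨ +-comm R'.#roots 1 ⟩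
        suc R'.#roots ∎
        where
        open ≡-Reasoning
        split : ∀ r → 𝟙 (isRootOf r) ≡ 𝟙 (R'.isRootOf r) + 𝟙 (r ==ᶠ root-of v)
        split r rewrite new-roots r with r ==ᶠ root-of v in e
        ... | true rewrite ==ᶠ-true e | root-of-isRoot v = refl
        ... | false rewrite ∧-identityʳ (isRootOf r) = sym (+-identityʳ _)
        count-rv : ∑ (allFin n) (λ r → 𝟙 (r ==ᶠ root-of v)) ≡ 1
        count-rv = trans (∑-cong' (allFin n) (λ r → sym (*-identityʳ _))) (∑-delta (root-of v) (λ _ → 1))

  merge-count : ∀ {n} (E E' : BoolEquivalence n) (u v : Fin n) → Merges E E' u v →
                BoolEquivalence._~_ E u v ≡ false → Roots.#roots E ≡ suc (Roots.#roots E')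
  merge-count E E' u v joins u≁v with <-cmp (toℕ (root-of u)) (toℕ (root-of v))
    where open Roots E
  ... | tri< lt _ _ = MergeOrdered.ordered-count E E' u v joins lt
  ... | tri≈ _ eq _ = ⊥-elim (true≢false (trans (sym (Roots.same-root⇒~ E (toℕ-injective eq))) u≁v))
  ... | tri> _ _ gt = MergeOrdered.ordered-count E E' v u (Merges-sym {E = E} {E'} joins) gt

module PairSums where

  open import Defs
  open BooleanReflection
  open FiniteSums
  open Components
  open import Data.Nat using (ℕ; _+_; _*_; _≤_; _<_; s≤s; _<ᵇ_)
  open import Data.Nat.Properties hiding (_≟_)
  open import Data.Nat.Tactic.RingSolver using (solve-∀)
  open import Data.Fin using (Fin; toℕ)
  open import Data.Fin.Properties using (toℕ-injective; any?; _≟_)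
  open import Data.Bool using (true; false; _∧_; not)
  open import Data.Bool.Properties using () renaming (_≟_ to _≟ᵇ_)
  open import Data.List using (List; allFin; map; concatMap)
  open import Data.Nat.ListAction using (sum)
  open import Data.Product using (_,_)
  open import Data.Empty using (⊥-elim)
  open import Relation.Nullary using (¬_; yes; no; ¬?)
  open import Relation.Nullary.Decidable using (_×-dec_)
  open import Relation.Binary.PropositionalEquality
  open import Relation.Binary.Definitions using (tri<; tri≈; tri>)

  lt : ∀ {n} → Fin n → Fin n → ℕ
  lt r r' = 𝟙 (toℕ r <ᵇ toℕ r')

  lt-total : ∀ {n} (a b : Fin n) → ¬ a ≡ b → lt a b + lt b a ≡ 1
  lt-total a b a≢b with <-cmp (toℕ a) (toℕ b)
  ... | tri< a<b _ b≮a rewrite <ᵇ-intro a<b | <ᵇ-false b≮a = refl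
  ... | tri≈ _ eq _ = ⊥-elim (a≢b (toℕ-injective eq))
  ... | tri> a≮b _ b<a rewrite <ᵇ-intro b<a | <ᵇ-false a≮b = refl

  lt-irrefl : ∀ {n} (a : Fin n) → lt a a ≡ 0
  lt-irrefl a rewrite <ᵇ-false (<-irrefl (refl {x = toℕ a})) = refl

  ∑∑-symmetrise : ∀ {n} (f g : Fin n → Fin n → ℕ) → (∀ a b → f a b + f b a ≡ g a b) →
                  let ∑∑ = λ (h : Fin n → Fin n → ℕ) → ∑ (allFin n) (λ a → ∑ (allFin n) (h a))
                  in ∑∑ f + ∑∑ f ≡ ∑∑ g
  ∑∑-symmetrise {n} f g split = begin
    ∑ V (λ a → ∑ V (f a)) + ∑ V (λ a → ∑ V (f a))
      ≡⟨ cong (∑ V (λ a → ∑ V (f a)) +_) (∑-swap V V f) ⟩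
    ∑ V (λ a → ∑ V (f a)) + ∑ V (λ a → ∑ V (λ b → f b a))
      ≡⟨ sym (∑-+ V _ _) ⟩
    ∑ V (λ a → ∑ V (f a) + ∑ V (λ b → f b a))
      ≡⟨ ∑-cong' V (λ a → trans (sym (∑-+ V (f a) (λ b → f b a))) (∑-cong' V (split a))) ⟩
    ∑ V (λ a → ∑ V (g a)) ∎
    where
    open ≡-Reasoning
    V = allFin n

  double-injective : ∀ {a b : ℕ} → a + a ≡ b + b → a ≡ b
  double-injective {a} {b} h with <-cmp a b
  ... | tri< lt _ _ = ⊥-elim (<-irrefl h (+-mono-< lt lt))
  ... | tri≈ _ e _ = e
  ... | tri> _ _ gt = ⊥-elim (<-irrefl (sym h) (+-mono-< gt gt))

  -- The sum over unordered pairs of distinct classes of the product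
  -- of their weights equals the sum of w a * w b over pairs of inequivalent
  -- vertices a < b.
  module CrossingWeights {n} (E : BoolEquivalence n) (w : Fin n → ℕ) where

    open BoolEquivalence E
    open Roots E

    V : List (Fin n)
    V = allFin n

    classWeight : Fin n → ℕ
    classWeight r = ∑ V (λ j → 𝟙 (r ~ j) * w j)

    rootList : List (Fin n)
    rootList = boolFilter isRootOf V

    -- The shape of Defs.pairSum, for an arbitrary weight function on roots.
    rootPairSum : (Fin n → ℕ) → ℕ
    rootPairSum cw =
      sum (concatMap (λ r → map (λ r' → cw r * cw r') (boolFilter (λ r' → toℕ r <ᵇ toℕ r') rootList)) rootList)

    byRoots : ℕ
    byRoots = ∑ V (λ a → ∑ V (λ b → w a * (w b * lt (root-of a) (root-of b))))

    byIndex : ℕ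
    byIndex = ∑ V (λ a → ∑ V (λ b → lt a b * (𝟙 (not (a ~ b)) * (w a * w b))))

    crossing : ℕ
    crossing = ∑ V (λ a → ∑ V (λ b → 𝟙 (not (a ~ b)) * (w a * w b)))

    ∑-over-roots : ∀ (h : Fin n → ℕ) → ∑ V (λ r → 𝟙 (isRootOf r) * (classWeight r * h r)) ≡ ∑ V (λ a → w a * h (root-of a))
    ∑-over-roots h = begin
      ∑ V (λ r → 𝟙 (isRootOf r) * (classWeight r * h r))
        ≡⟨ ∑-cong' V (λ r → expand r) ⟩
      ∑ V (λ r → ∑ V (λ a → 𝟙 (isRootOf r ∧ (r ~ a)) * (w a * h r)))
        ≡⟨ ∑-swap V V _ ⟩
      ∑ V (λ a → ∑ V (λ r → 𝟙 (isRootOf r ∧ (r ~ a)) * (w a * h r)))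
        ≡⟨ ∑-cong' V (λ a → ∑-root-of a (λ r → w a * h r)) ⟩
      ∑ V (λ a → w a * h (root-of a)) ∎
      where
      open ≡-Reasoning
      expand : ∀ r → 𝟙 (isRootOf r) * (classWeight r * h r) ≡ ∑ V (λ a → 𝟙 (isRootOf r ∧ (r ~ a)) * (w a * h r))
      expand r = begin
        𝟙 (isRootOf r) * (classWeight r * h r)
          ≡⟨ cong (𝟙 (isRootOf r) *_) (sym (∑-*ʳ V (h r) _)) ⟩
        𝟙 (isRootOf r) * ∑ V (λ a → 𝟙 (r ~ a) * w a * h r)
          ≡⟨ sym (∑-*ˡ V (𝟙 (isRootOf r)) _) ⟩
        ∑ V (λ a → 𝟙 (isRootOf r) * (𝟙 (r ~ a) * w a * h r))
          ≡⟨ ∑-cong' V (λ a → trans (reassoc (𝟙 (isRootOf r)) (𝟙 (r ~ a)) (w a) (h r))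
                                    (cong (_* (w a * h r)) (sym (𝟙-∧ (isRootOf r) (r ~ a))))) ⟩
        ∑ V (λ a → 𝟙 (isRootOf r ∧ (r ~ a)) * (w a * h r)) ∎
        where
        reassoc : ∀ x y z t → x * (y * z * t) ≡ x * y * (z * t)
        reassoc = solve-∀

    rootPairSum-byRoots : ∀ cw → (∀ r → cw r ≡ classWeight r) → rootPairSum cw ≡ byRoots
    rootPairSum-byRoots cw hcw = begin
      rootPairSum cw
        ≡⟨ trans (sum-map-id (concatMap products rootList)) (∑-concatMap rootList products (λ x → x)) ⟩
      ∑ rootList (λ r → ∑ (products r) (λ x → x))
        ≡⟨ ∑-cong' rootList (λ r → trans (∑-map (later r) (λ r' → cw r * cw r') (λ x → x))
                                         (∑-filter rootList (λ r' → toℕ r <ᵇ toℕ r') (λ r' → cw r * cw r'))) ⟩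
      ∑ rootList (λ r → ∑ rootList (λ r' → lt r r' * (cw r * cw r')))
        ≡⟨ ∑-filter V isRootOf _ ⟩
      ∑ V (λ r → 𝟙 (isRootOf r) * ∑ rootList (λ r' → lt r r' * (cw r * cw r')))
        ≡⟨ ∑-cong' V (λ r → cong (𝟙 (isRootOf r) *_) (inner r)) ⟩
      ∑ V (λ r → 𝟙 (isRootOf r) * (classWeight r * ∑ V (λ b → w b * lt r (root-of b))))
        ≡⟨ ∑-over-roots (λ r → ∑ V (λ b → w b * lt r (root-of b))) ⟩
      ∑ V (λ a → w a * ∑ V (λ b → w b * lt (root-of a) (root-of b)))
        ≡⟨ ∑-cong' V (λ a → sym (∑-*ˡ V (w a) _)) ⟩
      byRoots ∎
      where
      open ≡-Reasoning
      later : Fin n → List (Fin n)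
      later r = boolFilter (λ r' → toℕ r <ᵇ toℕ r') rootList
      products : Fin n → List ℕ
      products r = map (λ r' → cw r * cw r') (later r)
      sum-map-id : ∀ (L : List ℕ) → sum L ≡ ∑ L (λ x → x)
      sum-map-id L = trans (cong sum (sym (Data.List.Properties.map-id L))) (sum-map L (λ x → x))
        where import Data.List.Properties
      inner : ∀ r → ∑ rootList (λ r' → lt r r' * (cw r * cw r')) ≡ classWeight r * ∑ V (λ b → w b * lt r (root-of b))
      inner r = begin
        ∑ rootList (λ r' → lt r r' * (cw r * cw r'))
          ≡⟨ ∑-filter V isRootOf _ ⟩
        ∑ V (λ r' → 𝟙 (isRootOf r') * (lt r r' * (cw r * cw r')))
          ≡⟨ ∑-cong' V (λ r' → trans (cong (λ x → 𝟙 (isRootOf r') * (lt r r' * (x * cw r'))) (hcw r))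
                                     (trans (cong (λ x → 𝟙 (isRootOf r') * (lt r r' * (classWeight r * x))) (hcw r'))
                                            (shuffle (𝟙 (isRootOf r')) (lt r r') (classWeight r) (classWeight r')))) ⟩
        ∑ V (λ r' → classWeight r * (𝟙 (isRootOf r') * (classWeight r' * lt r r')))
          ≡⟨ ∑-*ˡ V (classWeight r) _ ⟩
        classWeight r * ∑ V (λ r' → 𝟙 (isRootOf r') * (classWeight r' * lt r r'))
          ≡⟨ cong (classWeight r *_) (∑-over-roots (lt r)) ⟩
        classWeight r * ∑ V (λ b → w b * lt r (root-of b)) ∎
        where
        shuffle : ∀ x y z t → x * (y * (z * t)) ≡ z * (x * (t * y))
        shuffle = solve-∀

    -- Two inequivalent vertices have distinct roots, so exactly one order.
    byRoots-double : byRoots + byRoots ≡ crossing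
    byRoots-double = ∑∑-symmetrise _ _ split
      where
      roots-order : ∀ a b → lt (root-of a) (root-of b) + lt (root-of b) (root-of a) ≡ 𝟙 (not (a ~ b))
      roots-order a b with a ~ b in a~b
      ... | true rewrite ~⇒same-root a~b = cong₂ _+_ (lt-irrefl (root-of b)) (lt-irrefl (root-of b))
      ... | false = lt-total _ _ (λ e → true≢false (trans (sym (same-root⇒~ e)) a~b))
      split : ∀ a b → w a * (w b * lt (root-of a) (root-of b)) + w b * (w a * lt (root-of b) (root-of a))
                      ≡ 𝟙 (not (a ~ b)) * (w a * w b)
      split a b = trans (factor (w a) (w b) (lt (root-of a) (root-of b)) (lt (root-of b) (root-of a)))
                        (cong (_* (w a * w b)) (roots-order a b))
        where
        factor : ∀ x y s t → x * (y * s) + y * (x * t) ≡ (s + t) * (x * y)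
        factor = solve-∀

    byIndex-double : byIndex + byIndex ≡ crossing
    byIndex-double = ∑∑-symmetrise _ _ split
      where
      ~-sym-bool : ∀ a b → (b ~ a) ≡ (a ~ b)
      ~-sym-bool a b = bool-ext ~-sym ~-sym
      index-order : ∀ a b → (lt a b + lt b a) * 𝟙 (not (a ~ b)) ≡ 𝟙 (not (a ~ b))
      index-order a b with a ≟ b
      ... | yes refl rewrite ~-refl a = *-zeroʳ (lt a a + lt a a)
      ... | no a≢b rewrite lt-total a b a≢b = +-identityʳ _
      split : ∀ a b → lt a b * (𝟙 (not (a ~ b)) * (w a * w b)) + lt b a * (𝟙 (not (b ~ a)) * (w b * w a))
                      ≡ 𝟙 (not (a ~ b)) * (w a * w b)
      split a b rewrite ~-sym-bool a b | *-comm (w b) (w a) =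
        trans (factor (lt a b) (lt b a) (𝟙 (not (a ~ b))) (w a * w b))
              (cong (_* (w a * w b)) (index-order a b))
        where
        factor : ∀ s t c m → s * (c * m) + t * (c * m) ≡ (s + t) * c * m
        factor = solve-∀

    byRoots≡byIndex : byRoots ≡ byIndex
    byRoots≡byIndex = double-injective (trans byRoots-double (sym byIndex-double))

    crossing-pair : (∀ j → 1 ≤ w j) → ∀ a b → lt (root-of a) (root-of b) ≡ 1 → 1 ≤ byRoots
    crossing-pair w≥1 a b ordered = begin
      1                                                       ≤⟨ *-mono-≤ (w≥1 a) (*-mono-≤ (w≥1 b) (≤-reflexive (sym ordered))) ⟩
      w a * (w b * lt (root-of a) (root-of b))                ≤⟨ term≤∑ V _ (∈-allFin b) ⟩
      ∑ V (λ b' → w a * (w b' * lt (root-of a) (root-of b'))) ≤⟨ term≤∑ V _ (∈-allFin a) ⟩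
      byRoots ∎
      where open ≤-Reasoning

    ordered-roots : ∀ {r r'} → isRootOf r ≡ true → isRootOf r' ≡ true → toℕ r < toℕ r' →
                    lt (root-of r) (root-of r') ≡ 1
    ordered-roots root root' r<r' rewrite root-of-root root | root-of-root root' | <ᵇ-intro r<r' = refl

    byRoots-positive : (∀ j → 1 ≤ w j) → (x₀ : Fin n) → 2 ≤ #roots → 1 ≤ byRoots
    byRoots-positive w≥1 x₀ two with any? (λ r → (isRootOf r ≟ᵇ true) ×-dec ¬? (r ≟ root-of x₀))
    ... | no none = ⊥-elim (2≰1 (≤-trans two (single-root (root-of x₀) only-r₀)))
      where
      2≰1 : ¬ 2 ≤ 1
      2≰1 (s≤s ())
      only-r₀ : ∀ r → isRootOf r ≡ true → r ≡ root-of x₀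
      only-r₀ r root with r ≟ root-of x₀
      ... | yes eq = eq
      ... | no ne = ⊥-elim (none (r , root , ne))
    ... | yes (r , root , r≢r₀) with <-cmp (toℕ r) (toℕ (root-of x₀))
    ...   | tri< r<r₀ _ _ = crossing-pair w≥1 r (root-of x₀) (ordered-roots root (root-of-isRoot x₀) r<r₀)
    ...   | tri≈ _ eq _ = ⊥-elim (r≢r₀ (toℕ-injective eq))
    ...   | tri> _ _ r₀<r = crossing-pair w≥1 (root-of x₀) r (ordered-roots (root-of-isRoot x₀) root r₀<r)

  pairSum≡byRoots : ∀ {n} (w : Fin n → ℕ) (F : List (Edge n)) → pairSum w F ≡ CrossingWeights.byRoots (sameComponent F) w
  pairSum≡byRoots {n} w F = rootPairSum-byRoots (compWeight w F) same-weight
    where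
    open CrossingWeights (sameComponent F) w
    same-weight : ∀ r → compWeight w F r ≡ classWeight r
    same-weight r = trans (sum-map (boolFilter (connected F r) (allFin n)) w) (∑-filter (allFin n) (connected F r) w)

  -- A forest with at least two components has a positive pair sum, so the
  -- denominator of φ does not vanish.
  pairSum-positive : ∀ {n} (w : Fin n → ℕ) → (∀ j → 1 ≤ w j) → Fin n →
                     ∀ F → 2 ≤ numComponents F → 1 ≤ pairSum w F
  pairSum-positive {n} w w≥1 x₀ F two = begin
    1            ≤⟨ byRoots-positive w≥1 x₀ (≤-trans two (≤-reflexive (length-filter (allFin n) (isRoot F)))) ⟩
    byRoots      ≡⟨ sym (pairSum≡byRoots w F) ⟩
    pairSum w F ∎
    where
    open ≤-Reasoning
    open CrossingWeights (sameComponent F) w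

module EdgeSets where

  open import Defs
  open BooleanReflection
  open FiniteSums
  open import Data.Nat using (ℕ; _+_; _*_; _≤_; _<_; _<ᵇ_)
  open import Data.Nat.Properties
  open import Data.Nat.Tactic.RingSolver using (solve-∀)
  open import Data.Fin using (Fin; toℕ)
  import Data.Fin.Properties as Fin
  open import Data.Bool using (Bool; true; false; _∧_; _∨_)
  open import Data.Bool.ListAction using (any)
  open import Data.List using (List; []; _∷_; _++_; allFin; map)
  import Data.List.Properties as List
  open import Data.List.Membership.Propositional using (_∈_)
  open import Data.List.Membership.Propositional.Properties using (∈-++⁻; ∈-map⁻; ∈-++⁺ˡ)
  open import Data.List.Relation.Unary.Any using (here; there)
  open import Data.List.Relation.Unary.All.Properties using (¬Any⇒All¬; All¬⇒¬Any)
  open import Data.List.Relation.Unary.Unique.Propositional using (Unique; []; _∷_)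
  open import Data.Product using (_,_; proj₁; proj₂)
  open import Function using (_∘_)
  import Data.Product.Properties as Product
  open import Data.Sum using (inj₁; inj₂)
  open import Data.Empty using (⊥-elim)
  open import Relation.Nullary using (¬_; yes; no)
  open import Relation.Nullary.Decidable using (isYes)
  open import Relation.Binary.PropositionalEquality
  open import Relation.Binary.Definitions using (DecidableEquality)

  -- The subsets of
  -- a duplicate-free list L are in bijection with the boolean predicates on L:
  -- a subset is the filter of L by its own membership test, and every filter
  -- of L occurs exactly once among subsets L.
  module ListSets {A : Set} (_≟_ : DecidableEquality A) (beq : A → A → Bool)
    (beq-true : ∀ {x y} → beq x y ≡ true → x ≡ y) (beq-refl : ∀ x → beq x x ≡ true) where

    mem : List A → A → Bool
    mem L x = any (beq x) L

    mem-true : ∀ {L x} → mem L x ≡ true → x ∈ L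
    mem-true {L} {x} h with any-true (beq x) L h
    ... | y , m , e rewrite beq-true e = m

    mem-intro : ∀ {L x} → x ∈ L → mem L x ≡ true
    mem-intro {L} {x} m = any-intro (beq x) L m (beq-refl x)

    mem-false : ∀ {L x} → ¬ x ∈ L → mem L x ≡ false
    mem-false x∉L = ≢true⇒false (λ h → x∉L (mem-true h))

    mem-filter : ∀ p (L : List A) y → mem (boolFilter p L) y ≡ (p y ∧ mem L y)
    mem-filter p L y = bool-ext
      (λ h → let m = mem-true h in cong₂ _∧_ (filter-prop p L m) (mem-intro (filter-⊆ p L m)))
      (λ h → mem-intro (filter-∈ p L (mem-true (proj₂ (∧-true h))) (proj₁ (∧-true h))))

    count : List A → A → ℕ
    count L a = ∑ L (λ x → 𝟙 (beq x a))

    count≤1⇒Unique : ∀ L → (∀ a → count L a ≤ 1) → Unique L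
    count≤1⇒Unique [] h = []
    count≤1⇒Unique (x ∷ xs) h =
      ¬Any⇒All¬ xs x∉xs ∷ count≤1⇒Unique xs (λ a → ≤-trans (m≤n+m _ (𝟙 (beq x a))) (h a))
      where
      x∉xs : ¬ x ∈ xs
      x∉xs m = <-irrefl refl (≤-trans (+-mono-≤ (≤-reflexive (cong 𝟙 (sym (beq-refl x))))
                                                (≤-trans (≤-reflexive (cong 𝟙 (sym (beq-refl x))))
                                                         (term≤∑ xs (λ y → 𝟙 (beq y x)) m)))
                                     (h x))

    subset-⊆ : ∀ (L : List A) {T y} → T ∈ subsets L → y ∈ T → y ∈ L
    subset-⊆ (x ∷ L) {T} mT my with ∈-++⁻ (subsets L) mT
    ... | inj₁ m₁ = there (subset-⊆ L m₁ my)
    ... | inj₂ m₂ with ∈-map⁻ (x ∷_) m₂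
    ...   | T' , mT' , refl with my
    ...     | here e = here e
    ...     | there my' = there (subset-⊆ L mT' my')
    subset-⊆ [] (here refl) ()

    []∈subsets : ∀ (L : List A) → [] ∈ subsets L
    []∈subsets [] = here refl
    []∈subsets (x ∷ L) = ∈-++⁺ˡ ([]∈subsets L)

    subset-filter : ∀ {L : List A} → Unique L → ∀ {T} → T ∈ subsets L → T ≡ boolFilter (mem T) L
    subset-filter {[]} [] (here refl) = refl
    subset-filter {x ∷ L} (x∉ ∷ uniq) {T} mT with ∈-++⁻ (subsets L) mT
    ... | inj₁ m₁ rewrite mem-false {T} {x} (λ m → All¬⇒¬Any x∉ (subset-⊆ L m₁ m)) = subset-filter uniq m₁
    ... | inj₂ m₂ with ∈-map⁻ (x ∷_) m₂
    ...   | T' , mT' , refl rewrite beq-refl x =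
      cong (x ∷_) (trans (subset-filter uniq mT') (filter-cong L (λ y my → sym (cong (_∨ mem T' y) (x≠y y my)))))
      where
      x≠y : ∀ y → y ∈ L → beq y x ≡ false
      x≠y y my = ≢true⇒false (λ h → All¬⇒¬Any x∉ (subst (_∈ L) (beq-true h) my))

    sameList : List A → List A → Bool
    sameList T T' = isYes (List.≡-dec _≟_ T T')

    sameList-true : ∀ {T T'} → sameList T T' ≡ true → T ≡ T'
    sameList-true {T} {T'} h with List.≡-dec _≟_ T T'
    ... | yes e = e

    sameList-refl : ∀ T → sameList T T ≡ true
    sameList-refl T with List.≡-dec _≟_ T T
    ... | yes _ = refl
    ... | no ne = ⊥-elim (ne refl)

    sameList-false : ∀ {T T'} → ¬ T ≡ T' → sameList T T' ≡ false
    sameList-false ne = ≢true⇒false (λ h → ne (sameList-true h))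

    sameList-∷ : ∀ x T T' → sameList (x ∷ T) (x ∷ T') ≡ sameList T T'
    sameList-∷ x T T' = bool-ext
      (λ h → sameList-intro (List.∷-injectiveʳ (sameList-true h)))
      (λ h → sameList-intro (cong (x ∷_) (sameList-true h)))
      where
      sameList-intro : ∀ {U U'} → U ≡ U' → sameList U U' ≡ true
      sameList-intro {U} refl = sameList-refl U

    sameList-separated : ∀ {x T U} → x ∈ U → ¬ x ∈ T → sameList T U ≡ false
    sameList-separated x∈U x∉T = sameList-false (λ e → x∉T (subst (_ ∈_) (sym e) x∈U))

    filter-once : ∀ {L : List A} → Unique L → ∀ p → ∑ (subsets L) (λ T → 𝟙 (sameList T (boolFilter p L))) ≡ 1
    filter-once {[]} [] p = refl
    filter-once {x ∷ L} (x∉ ∷ uniq) p with p x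
    ... | true = begin
      ∑ (subsets L ++ map (x ∷_) (subsets L)) (λ T → 𝟙 (sameList T (x ∷ F)))
        ≡⟨ ∑-++ (subsets L) _ _ ⟩
      ∑ (subsets L) (λ T → 𝟙 (sameList T (x ∷ F))) + ∑ (map (x ∷_) (subsets L)) (λ T → 𝟙 (sameList T (x ∷ F)))
        ≡⟨ cong₂ _+_ (∑-zero (subsets L) _ (λ T mT → cong 𝟙 (sameList-separated (here refl) (x∉L ∘ subset-⊆ L mT))))
                     (trans (∑-map (subsets L) (x ∷_) _) (∑-cong' (subsets L) (λ T → cong 𝟙 (sameList-∷ x T F)))) ⟩
      0 + ∑ (subsets L) (λ T → 𝟙 (sameList T F))
        ≡⟨ filter-once uniq p ⟩
      1 ∎
      where
      open ≡-Reasoning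
      F = boolFilter p L
      x∉L : ¬ x ∈ L
      x∉L = All¬⇒¬Any x∉
    ... | false = begin
      ∑ (subsets L ++ map (x ∷_) (subsets L)) (λ T → 𝟙 (sameList T F))
        ≡⟨ ∑-++ (subsets L) _ _ ⟩
      ∑ (subsets L) (λ T → 𝟙 (sameList T F)) + ∑ (map (x ∷_) (subsets L)) (λ T → 𝟙 (sameList T F))
        ≡⟨ cong₂ _+_ (filter-once uniq p)
                     (trans (∑-map (subsets L) (x ∷_) _) (∑-zero (subsets L) _ (λ T _ → cong 𝟙 (x∷T≢F T)))) ⟩
      1 + 0 ∎
      where
      open ≡-Reasoning
      F = boolFilter p L
      x∷T≢F : ∀ T → sameList (x ∷ T) F ≡ false
      x∷T≢F T = sameList-false (λ e → All¬⇒¬Any x∉ (filter-⊆ p L (subst (x ∈_) e (here refl))))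

  ==ₑ-true : ∀ {n} {x y : Edge n} → (x ==ₑ y) ≡ true → x ≡ y
  ==ₑ-true {x = a , b} {c , d} h with ∧-true {a ==ᶠ c} h
  ... | h₁ , h₂ rewrite ==ᶠ-true h₁ | ==ᶠ-true h₂ = refl

  ==ₑ-refl : ∀ {n} (x : Edge n) → (x ==ₑ x) ≡ true
  ==ₑ-refl (a , b) rewrite ==ᶠ-refl a | ==ᶠ-refl b = refl

  _≟ₑ_ : ∀ {n} → DecidableEquality (Edge n)
  _≟ₑ_ = Product.≡-dec Fin._≟_ Fin._≟_

  -- With beq = _==ₑ_, the membership test mem of ListSets is Defs._∈ₑ_.
  open module EdgeListSets {n : ℕ} = ListSets {Edge n} _≟ₑ_ _==ₑ_ ==ₑ-true ==ₑ-refl public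

  ∑-allEdges : ∀ n (g : Edge n → ℕ) →
               ∑ (allEdges n) g ≡ ∑ (allFin n) (λ a → ∑ (allFin n) (λ b → 𝟙 (toℕ a <ᵇ toℕ b) * g (a , b)))
  ∑-allEdges n g =
    trans (∑-concatMap (allFin n) _ g)
          (∑-cong' (allFin n) (λ a → trans (∑-map (boolFilter (λ v → toℕ a <ᵇ toℕ v) (allFin n)) (λ v → (a , v)) g)
                                           (∑-filter (allFin n) (λ v → toℕ a <ᵇ toℕ v) (λ v → g (a , v)))))

  ∑-allEdges-delta : ∀ n (e : Edge n) (g : Edge n → ℕ) →
                     ∑ (allEdges n) (λ x → 𝟙 (x ==ₑ e) * g x) ≡ 𝟙 (toℕ (proj₁ e) <ᵇ toℕ (proj₂ e)) * g e
  ∑-allEdges-delta n (e₁ , e₂) g =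
    trans (∑-allEdges n _)
          (trans (∑-cong' (allFin n) (λ a → trans (∑-cong' (allFin n) (λ b → factor a b)) (∑-*ˡ (allFin n) (𝟙 (a ==ᶠ e₁)) _)))
                 (trans (∑-delta e₁ _) (∑-delta e₂ (λ b → 𝟙 (toℕ e₁ <ᵇ toℕ b) * g (e₁ , b)))))
    where
    factor : ∀ a b → 𝟙 (toℕ a <ᵇ toℕ b) * (𝟙 ((a , b) ==ₑ (e₁ , e₂)) * g (a , b))
                     ≡ 𝟙 (a ==ᶠ e₁) * (𝟙 (b ==ᶠ e₂) * (𝟙 (toℕ a <ᵇ toℕ b) * g (a , b)))
    factor a b rewrite 𝟙-∧ (a ==ᶠ e₁) (b ==ᶠ e₂) = shuffle (𝟙 (toℕ a <ᵇ toℕ b)) (𝟙 (a ==ᶠ e₁)) (𝟙 (b ==ᶠ e₂)) (g (a , b))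
      where
      shuffle : ∀ x y z t → x * (y * z * t) ≡ y * (z * (x * t))
      shuffle = solve-∀

  count-allEdges : ∀ n (e : Edge n) → count (allEdges n) e ≡ 𝟙 (toℕ (proj₁ e) <ᵇ toℕ (proj₂ e))
  count-allEdges n e =
    trans (∑-cong' (allEdges n) (λ x → sym (*-identityʳ _))) (trans (∑-allEdges-delta n e (λ _ → 1)) (*-identityʳ _))

  allEdges-unique : ∀ n → Unique (allEdges n)
  allEdges-unique n = count≤1⇒Unique (allEdges n) (λ e → ≤-trans (≤-reflexive (count-allEdges n e)) (𝟙≤1 _))

  allEdges-ordered : ∀ {n} {e : Edge n} → e ∈ allEdges n → toℕ (proj₁ e) < toℕ (proj₂ e)
  allEdges-ordered {n} {e} m = <ᵇ-true (𝟙≡1 (begin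
    1                          ≡⟨ cong 𝟙 (sym (==ₑ-refl e)) ⟩
    𝟙 (e ==ₑ e)                ≤⟨ term≤∑ (allEdges n) (λ y → 𝟙 (y ==ₑ e)) m ⟩
    count (allEdges n) e       ≡⟨ count-allEdges n e ⟩
    𝟙 (toℕ (proj₁ e) <ᵇ toℕ (proj₂ e)) ∎))
    where
    open ≤-Reasoning
    𝟙≡1 : ∀ {b} → 1 ≤ 𝟙 b → b ≡ true
    𝟙≡1 {true} _ = refl

module AddingAnEdge where

  open import Defs
  open BooleanReflection
  open FiniteSums
  open Reachability
  open Components
  open EdgeSets
  open import Data.Nat using (suc)
  open import Data.Nat.Properties
  open import Data.Fin using (Fin)
  open import Data.Bool using (true; false; _∧_; _∨_; not)
  open import Data.Bool.Properties using (∨-zeroʳ)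
  open import Data.List using (List; allFin)
  open import Data.List.Membership.Propositional using (_∈_)
  open import Data.Product using (_×_; _,_; proj₁; proj₂)
  open import Data.Sum using (_⊎_; inj₁; inj₂)
  open import Data.Empty using (⊥; ⊥-elim)
  open import Relation.Nullary using (¬_)
  open import Relation.Binary.PropositionalEquality

  -- Reachability after adding an edge uv to G: a walk in G + uv either avoids
  -- the new edge, or passes from the part reachable from u to the part
  -- reachable from v (in one direction or the other).
  module ReachWithNewEdge {n} (G G' : List (Edge n)) (u v : Fin n)
    (old : ∀ x → x ∈ G → x ∈ G') (new : (u , v) ∈ G')
    (only : ∀ x → x ∈ G' → (x ≡ (u , v)) ⊎ (x ∈ G)) where

    Via : Fin n → Fin n → Set
    Via a b = Reach G a b ⊎ ((Reach G a u × Reach G v b) ⊎ (Reach G a v × Reach G u b))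

    private
      extend-fw : ∀ {a x y} → Via a x → (x , y) ∈ G → Via a y
      extend-fw (inj₁ r) m = inj₁ (forward r m)
      extend-fw (inj₂ (inj₁ (r₁ , r₂))) m = inj₂ (inj₁ (r₁ , forward r₂ m))
      extend-fw (inj₂ (inj₂ (r₁ , r₂))) m = inj₂ (inj₂ (r₁ , forward r₂ m))

      extend-bw : ∀ {a x y} → Via a y → (x , y) ∈ G → Via a x
      extend-bw (inj₁ r) m = inj₁ (backward r m)
      extend-bw (inj₂ (inj₁ (r₁ , r₂))) m = inj₂ (inj₁ (r₁ , backward r₂ m))
      extend-bw (inj₂ (inj₂ (r₁ , r₂))) m = inj₂ (inj₂ (r₁ , backward r₂ m))

      cross-uv : ∀ {a} → Via a u → Via a v
      cross-uv (inj₁ r) = inj₂ (inj₁ (r , here))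
      cross-uv (inj₂ (inj₁ (r₁ , r₂))) = inj₁ (Reach-trans r₁ (Reach-sym r₂))
      cross-uv (inj₂ (inj₂ (r₁ , r₂))) = inj₁ r₁

      cross-vu : ∀ {a} → Via a v → Via a u
      cross-vu (inj₁ r) = inj₂ (inj₂ (r , here))
      cross-vu (inj₂ (inj₁ (r₁ , r₂))) = inj₁ r₁
      cross-vu (inj₂ (inj₂ (r₁ , r₂))) = inj₁ (Reach-trans r₁ (Reach-sym r₂))

    to-Via : ∀ {a b} → Reach G' a b → Via a b
    to-Via here = inj₁ here
    to-Via (forward {x} {y} p m) with only (x , y) m
    ... | inj₁ refl = cross-uv (to-Via p)
    ... | inj₂ mG = extend-fw (to-Via p) mG
    to-Via (backward {x} {y} p m) with only (x , y) m
    ... | inj₁ refl = cross-vu (to-Via p)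
    ... | inj₂ mG = extend-bw (to-Via p) mG

    from-Via : ∀ {a b} → Via a b → Reach G' a b
    from-Via (inj₁ r) = Reach-mono old r
    from-Via (inj₂ (inj₁ (r₁ , r₂))) = Reach-trans (Reach-mono old r₁) (Reach-trans (Reach-edge new) (Reach-mono old r₂))
    from-Via (inj₂ (inj₂ (r₁ , r₂))) =
      Reach-trans (Reach-mono old r₁) (Reach-trans (Reach-sym (Reach-edge new)) (Reach-mono old r₂))

    merges : Merges (sameComponent G) (sameComponent G') u v
    merges a b = bool-ext to from
      where
      c = connected G
      to : connected G' a b ≡ true → (c a b ∨ ((c a u ∧ c v b) ∨ (c a v ∧ c u b))) ≡ true
      to h with to-Via (connected⇒Reach G' h)
      ... | inj₁ r rewrite Reach⇒connected G r = refl
      ... | inj₂ (inj₁ (r₁ , r₂)) rewrite Reach⇒connected G r₁ | Reach⇒connected G r₂ = ∨-zeroʳ (c a b)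
      ... | inj₂ (inj₂ (r₁ , r₂)) rewrite Reach⇒connected G r₁ | Reach⇒connected G r₂ =
        trans (cong (c a b ∨_) (∨-zeroʳ _)) (∨-zeroʳ (c a b))
      from : (c a b ∨ ((c a u ∧ c v b) ∨ (c a v ∧ c u b))) ≡ true → connected G' a b ≡ true
      from h = Reach⇒connected G' (from-Via (via h))
        where
        both : ∀ {p q r s} → (c p q ∧ c r s) ≡ true → Reach G p q × Reach G r s
        both h = connected⇒Reach G (proj₁ (∧-true h)) , connected⇒Reach G (proj₂ (∧-true h))
        via : (c a b ∨ ((c a u ∧ c v b) ∨ (c a v ∧ c u b))) ≡ true → Via a b
        via h with ∨-true {c a b} h
        ... | inj₁ direct = inj₁ (connected⇒Reach G direct)
        ... | inj₂ across with ∨-true {c a u ∧ c v b} across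
        ...   | inj₁ uv = inj₂ (inj₁ (both uv))
        ...   | inj₂ vu = inj₂ (inj₂ (both vu))

  addEdge : ∀ {n} → List (Edge n) → Edge n → List (Edge n)
  addEdge {n} F e = boolFilter (λ x → (x ==ₑ e) ∨ mem F x) (allEdges n)

  module _ {n} {F : List (Edge n)} {e : Edge n} where

    ∈-addEdge : ∀ {x} → x ∈ addEdge F e → (x ≡ e) ⊎ (x ∈ F)
    ∈-addEdge {x} m with ∨-true {x ==ₑ e} (filter-prop _ (allEdges n) m)
    ... | inj₁ h = inj₁ (==ₑ-true h)
    ... | inj₂ h = inj₂ (mem-true h)

    addEdge-old : (∀ x → x ∈ F → x ∈ allEdges n) → ∀ {x} → x ∈ F → x ∈ addEdge F e
    addEdge-old F⊆ {x} m = filter-∈ _ (allEdges n) (F⊆ x m) (trans (cong ((x ==ₑ e) ∨_) (mem-intro m)) (∨-zeroʳ _))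

    addEdge-new : e ∈ allEdges n → e ∈ addEdge F e
    addEdge-new m = filter-∈ _ (allEdges n) m (cong (_∨ mem F e) (==ₑ-refl e))

  ∈-delete : ∀ {n} {x y : Edge n} {G} → y ∈ delete x G → (y ∈ G) × ¬ (y ≡ x)
  ∈-delete {x = x} {G = G} m =
    filter-⊆ _ G m , λ e → true≢false (trans (sym (filter-prop _ G m)) (cong not (trans (cong (_==ₑ x) e) (==ₑ-refl x))))

  delete-∈ : ∀ {n} {x y : Edge n} {G} → y ∈ G → ¬ (y ≡ x) → y ∈ delete x G
  delete-∈ {G = G} m ne = filter-∈ _ G m (cong not (≢true⇒false (λ h → ne (==ₑ-true h))))

  module JoinComponents {n} (F : List (Edge n)) (F⊆ : ∀ x → x ∈ F → x ∈ allEdges n) (forest : isForest F ≡ true)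
    (u v : Fin n) (potential : (u , v) ∈ allEdges n) (apart : connected F u v ≡ false) where

    e : Edge n
    e = (u , v)

    F+e : List (Edge n)
    F+e = addEdge F e

    ¬u~v : ¬ Reach F u v
    ¬u~v = disconnected⇒¬Reach F apart

    e∉F : ¬ e ∈ F
    e∉F m = ¬u~v (Reach-edge m)

    forest-edge : ∀ {x} → x ∈ F → ¬ Reach (delete x F) (proj₁ x) (proj₂ x)
    forest-edge m = disconnected⇒¬Reach (delete _ F) (not-true (all-true _ F forest m))

    -- Removing the new edge leaves (a part of) F, where u and v are apart.
    new-edge-acyclic : ¬ Reach (delete e F+e) u v
    new-edge-acyclic r = ¬u~v (Reach-mono only-F r)
      where
      only-F : ∀ y → y ∈ delete e F+e → y ∈ F
      only-F y my with ∈-delete {G = F+e} my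
      ... | my' , y≢e with ∈-addEdge {F = F} my'
      ...   | inj₁ y≡e = ⊥-elim (y≢e y≡e)
      ...   | inj₂ mF = mF

    -- Removing an old edge ab: a walk from a to b in (F - ab) + uv would either
    -- avoid uv (impossible as F is a forest) or join u and v through ab in F.
    old-edge-acyclic : ∀ {a b} → (a , b) ∈ F → ¬ Reach (delete (a , b) F+e) a b
    old-edge-acyclic {a} {b} mF r = absurd (ReachWithNewEdge.to-Via H H' u v old new only r)
      where
      x = (a , b)
      H = delete x F
      H' = delete x F+e
      old : ∀ y → y ∈ H → y ∈ H'
      old y my = delete-∈ {G = F+e} (addEdge-old {F = F} F⊆ (proj₁ (∈-delete {G = F} my))) (proj₂ (∈-delete {G = F} my))
      new : e ∈ H'
      new = delete-∈ {G = F+e} (addEdge-new {F = F} potential) (λ eq → e∉F (subst (_∈ F) (sym eq) mF))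
      only : ∀ y → y ∈ H' → (y ≡ e) ⊎ (y ∈ H)
      only y my with ∈-delete {G = F+e} my
      ... | my' , y≢x with ∈-addEdge {F = F} my'
      ...   | inj₁ y≡e = inj₁ y≡e
      ...   | inj₂ mF' = inj₂ (delete-∈ {G = F} mF' y≢x)
      inF : ∀ {p q} → Reach H p q → Reach F p q
      inF = Reach-mono (λ y my → proj₁ (∈-delete {G = F} my))
      absurd : ReachWithNewEdge.Via H H' u v old new only a b → ⊥
      absurd (inj₁ r) = forest-edge mF r
      absurd (inj₂ (inj₁ (a~u , v~b))) =
        ¬u~v (Reach-trans (Reach-sym (inF a~u)) (Reach-trans (Reach-edge mF) (Reach-sym (inF v~b))))
      absurd (inj₂ (inj₂ (a~v , u~b))) =
        ¬u~v (Reach-trans (inF u~b) (Reach-trans (Reach-sym (Reach-edge mF)) (inF a~v)))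

    isForest-F+e : isForest F+e ≡ true
    isForest-F+e = all-intro _ F+e (λ x m → cong not (¬Reach⇒disconnected _ (acyclic-at (∈-addEdge {F = F} m))))
      where
      acyclic-at : ∀ {x} → (x ≡ e) ⊎ (x ∈ F) → ¬ Reach (delete x F+e) (proj₁ x) (proj₂ x)
      acyclic-at (inj₁ refl) = new-edge-acyclic
      acyclic-at (inj₂ mF) = old-edge-acyclic mF

    numComponents-F+e : numComponents F ≡ suc (numComponents F+e)
    numComponents-F+e = begin
      numComponents F                          ≡⟨ length-filter (allFin n) (isRoot F) ⟩
      Roots.#roots (sameComponent F)           ≡⟨ merge-count (sameComponent F) (sameComponent F+e) u v merges apart ⟩
      suc (Roots.#roots (sameComponent F+e))   ≡⟨ cong suc (sym (length-filter (allFin n) (isRoot F+e))) ⟩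
      suc (numComponents F+e) ∎
      where
      open ≡-Reasoning
      open ReachWithNewEdge F F+e u v (λ x → addEdge-old {F = F} F⊆) (addEdge-new {F = F} potential) (λ x → ∈-addEdge {F = F})

module Mass where

  open import Defs
  open BooleanReflection
  open FiniteSums
  open EdgeSets
  open AddingAnEdge
  open import Data.Nat using (ℕ; _+_; _*_; _^_; _<ᵇ_)
  open import Data.Nat.Properties
  open import Data.Fin using (Fin; toℕ)
  open import Data.Bool using (Bool; true; false; _∨_)
  open import Data.List using (List; allFin)
  open import Data.List.Membership.Propositional using (_∈_)
  open import Data.Product using (_×_; _,_; proj₁; proj₂)
  open import Relation.Nullary using (¬_)
  open import Relation.Binary.PropositionalEquality

  -- Adding to F a potential edge uv not in F raises the degrees of u and v by
  -- one, so it multiplies mass(F) = ∏ w_j ^ d_F(j) by w_u * w_v.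
  module _ {n} (F : List (Edge n)) (F⊆ : F ∈ subsets (allEdges n)) (u v : Fin n)
    (potential : (u , v) ∈ allEdges n) (new : mem F (u , v) ≡ false) where

    private
      E = allEdges n
      e = (u , v)

      incident : Fin n → Edge n → Bool
      incident j x = (proj₁ x ==ᶠ j) ∨ (proj₂ x ==ᶠ j)

      degree-∑ : ∀ G j → degree G j ≡ ∑ G (λ x → 𝟙 (incident j x))
      degree-∑ G j = length-filter G (incident j)

      in-F+e : ∀ x → 𝟙 ((x ==ₑ e) ∨ mem F x) ≡ 𝟙 (x ==ₑ e) + 𝟙 (mem F x)
      in-F+e x with x ==ₑ e in eq
      ... | true = cong (λ b → 1 + 𝟙 b) (sym (trans (cong (mem F) (==ₑ-true {x = x} {y = e} eq)) new))
      ... | false = refl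

      ends-distinct : ∀ j → ¬ (((u ==ᶠ j) ≡ true) × ((v ==ᶠ j) ≡ true))
      ends-distinct j (h₁ , h₂) = <-irrefl (cong toℕ (trans (==ᶠ-true h₁) (sym (==ᶠ-true h₂)))) (allEdges-ordered potential)

    degree-addEdge : ∀ j → degree (addEdge F e) j ≡ degree F j + (𝟙 (u ==ᶠ j) + 𝟙 (v ==ᶠ j))
    degree-addEdge j = begin
      degree (addEdge F e) j
        ≡⟨ trans (degree-∑ (addEdge F e) j) (∑-filter E _ (λ x → 𝟙 (incident j x))) ⟩
      ∑ E (λ x → 𝟙 ((x ==ₑ e) ∨ mem F x) * 𝟙 (incident j x))
        ≡⟨ ∑-cong' E (λ x → trans (cong (_* 𝟙 (incident j x)) (in-F+e x)) (*-distribʳ-+ _ (𝟙 (x ==ₑ e)) _)) ⟩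
      ∑ E (λ x → 𝟙 (x ==ₑ e) * 𝟙 (incident j x) + 𝟙 (mem F x) * 𝟙 (incident j x))
        ≡⟨ trans (∑-+ E (λ x → 𝟙 (x ==ₑ e) * 𝟙 (incident j x)) (λ x → 𝟙 (mem F x) * 𝟙 (incident j x)))
                   (+-comm (∑ E (λ x → 𝟙 (x ==ₑ e) * 𝟙 (incident j x))) _) ⟩
      ∑ E (λ x → 𝟙 (mem F x) * 𝟙 (incident j x)) + ∑ E (λ x → 𝟙 (x ==ₑ e) * 𝟙 (incident j x))
        ≡⟨ cong₂ _+_ old-edges new-edge ⟩
      degree F j + (𝟙 (u ==ᶠ j) + 𝟙 (v ==ᶠ j)) ∎
      where
      open ≡-Reasoning
      old-edges : ∑ E (λ x → 𝟙 (mem F x) * 𝟙 (incident j x)) ≡ degree F j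
      old-edges = sym (begin
        degree F j
          ≡⟨ degree-∑ F j ⟩
        ∑ F (λ x → 𝟙 (incident j x))
          ≡⟨ cong (λ L → ∑ L (λ x → 𝟙 (incident j x))) (subset-filter (allEdges-unique n) F⊆) ⟩
        ∑ (boolFilter (mem F) E) (λ x → 𝟙 (incident j x))
          ≡⟨ ∑-filter E (mem F) (λ x → 𝟙 (incident j x)) ⟩
        ∑ E (λ x → 𝟙 (mem F x) * 𝟙 (incident j x)) ∎)
      new-edge : ∑ E (λ x → 𝟙 (x ==ₑ e) * 𝟙 (incident j x)) ≡ 𝟙 (u ==ᶠ j) + 𝟙 (v ==ᶠ j)
      new-edge = begin
        ∑ E (λ x → 𝟙 (x ==ₑ e) * 𝟙 (incident j x))
          ≡⟨ ∑-allEdges-delta n e (λ x → 𝟙 (incident j x)) ⟩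
        𝟙 (toℕ u <ᵇ toℕ v) * 𝟙 (incident j e)
          ≡⟨ cong (λ b → 𝟙 b * 𝟙 (incident j e)) (<ᵇ-intro (allEdges-ordered potential)) ⟩
        1 * 𝟙 (incident j e)
          ≡⟨ +-identityʳ _ ⟩
        𝟙 (incident j e)
          ≡⟨ 𝟙-∨-disjoint (u ==ᶠ j) (v ==ᶠ j) (ends-distinct j) ⟩
        𝟙 (u ==ᶠ j) + 𝟙 (v ==ᶠ j) ∎

    mass-addEdge : ∀ (w : Fin n → ℕ) → mass w (addEdge F e) ≡ mass w F * (w u * w v)
    mass-addEdge w = begin
      mass w (addEdge F e)
        ≡⟨ product-map V _ ⟩
      ∏ V (λ j → w j ^ degree (addEdge F e) j)
        ≡⟨ ∏-cong V (λ j → trans (cong (w j ^_) (degree-addEdge j)) (split-power j)) ⟩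
      ∏ V (λ j → w j ^ degree F j * (w j ^ 𝟙 (u ==ᶠ j) * w j ^ 𝟙 (v ==ᶠ j)))
        ≡⟨ trans (∏-* V _ _) (cong (∏ V (λ j → w j ^ degree F j) *_) (∏-* V _ _)) ⟩
      ∏ V (λ j → w j ^ degree F j) * (∏ V (λ j → w j ^ 𝟙 (u ==ᶠ j)) * ∏ V (λ j → w j ^ 𝟙 (v ==ᶠ j)))
        ≡⟨ cong₂ _*_ (sym (product-map V _)) (cong₂ _*_ (∏-delta u w) (∏-delta v w)) ⟩
      mass w F * (w u * w v) ∎
      where
      open ≡-Reasoning
      V = allFin n
      split-power : ∀ j → w j ^ (degree F j + (𝟙 (u ==ᶠ j) + 𝟙 (v ==ᶠ j)))
                          ≡ w j ^ degree F j * (w j ^ 𝟙 (u ==ᶠ j) * w j ^ 𝟙 (v ==ᶠ j))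
      split-power j = trans (^-distribˡ-+-* (w j) (degree F j) _)
                            (cong (w j ^ degree F j *_) (^-distribˡ-+-* (w j) (𝟙 (u ==ᶠ j)) (𝟙 (v ==ᶠ j))))

module Transitions where

  open import Defs
  open BooleanReflection
  open FiniteSums
  open Reachability
  open Components
  open PairSums
  open EdgeSets
  open AddingAnEdge
  open Mass
  open import Data.Nat using (ℕ; suc; _*_; _≡ᵇ_)
  open import Data.Nat.Properties
  open import Data.Nat.Tactic.RingSolver using (solve-∀)
  open import Data.Fin using (Fin)
  open import Data.Bool using (Bool; true; false; _∧_; _∨_; not)
  open import Data.Bool.Properties using (∧-zeroʳ; ∧-identityʳ)
  open import Data.Bool.ListAction using (any; all)
  open import Data.List using (List; []; _∷_)
  open import Data.List.Membership.Propositional using (_∈_)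
  open import Data.List.Relation.Unary.Any using (here; there)
  open import Data.List.Relation.Unary.All.Properties using (All¬⇒¬Any)
  open import Data.List.Relation.Unary.Unique.Propositional using (Unique; _∷_)
  open import Data.Product using (_×_; _,_; proj₁; proj₂)
  open import Data.Sum using (inj₁; inj₂)
  open import Data.Empty using (⊥-elim)
  open import Relation.Binary.PropositionalEquality

  𝟙-any : ∀ {A : Set} (p : A → Bool) L → Unique L →
          (∀ x y → x ∈ L → y ∈ L → p x ≡ true → p y ≡ true → x ≡ y) →
          𝟙 (any p L) ≡ ∑ L (λ x → 𝟙 (p x))
  𝟙-any p [] _ _ = refl
  𝟙-any p (x ∷ xs) (x∉ ∷ uniq) atMostOne with p x in px
  ... | true = cong suc (sym (∑-zero xs _ (λ y my → cong 𝟙 (≢true⇒false (λ py →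
                 All¬⇒¬Any x∉ (subst (_∈ xs) (atMostOne y x (there my) (here refl) py px) my))))))
  ... | false = 𝟙-any p xs uniq (λ a b ma mb → atMostOne a b (there ma) (there mb))

  forestsWith-member : ∀ {n i F} → F ∈ forestsWith n i →
                       F ∈ subsets (allEdges n) × isForest F ≡ true × numComponents F ≡ i
  forestsWith-member {n} {i} m =
    filter-⊆ isForest (subsets (allEdges n)) forest ,
    filter-prop isForest (subsets (allEdges n)) forest ,
    ≡ᵇ-true (filter-prop (λ T → numComponents T ≡ᵇ i) (forests n) m)
    where
    forest = filter-⊆ (λ T → numComponents T ≡ᵇ i) (forests n) m

  -- Their total mass is mass(F) times the sum
  -- of w(T) w(T') over unordered pairs of components: each potential edge uv
  -- between distinct components gives exactly one such forest, of mass
  -- mass(F) w_u w_v, and the weights w_u w_v add up to that pair sum.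
  module Successors {n} (w : Fin n → ℕ) (i : ℕ) (F : List (Edge n)) (F⊆ : F ∈ subsets (allEdges n))
    (forest : isForest F ≡ true) (components : numComponents F ≡ suc i) where

    E = allEdges n

    F⊆E : ∀ x → x ∈ F → x ∈ E
    F⊆E x m = subset-⊆ E F⊆ m

    inF+e : Edge n → Edge n → Bool
    inF+e e x = (x ==ₑ e) ∨ mem F x

    extends-by : List (Edge n) → Edge n → Bool
    extends-by F' e = not (mem F e) ∧ sameList F' (addEdge F e)

    admissible : Edge n → Bool
    admissible e = not (mem F e) ∧ (isForest (addEdge F e) ∧ (numComponents (addEdge F e) ≡ᵇ i))

    admissible⇔apart : ∀ u v → (u , v) ∈ E → admissible (u , v) ≡ not (connected F u v)
    admissible⇔apart u v potential with connected F u v in uv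
    ... | false rewrite mem-false {L = F} (JoinComponents.e∉F F F⊆E forest u v potential uv)
                      | JoinComponents.isForest-F+e F F⊆E forest u v potential uv
      = ≡ᵇ-intro (sym (suc-injective (trans (sym components) (JoinComponents.numComponents-F+e F F⊆E forest u v potential uv))))
    ... | true with mem F (u , v) in old
    ...   | true = refl
    ...   | false = cong (_∧ (numComponents (addEdge F e) ≡ᵇ i))
                         (all-false _ (addEdge F e) (addEdge-new {F = F} potential) (cong not cycle))
      where
      e = (u , v)
      -- F + uv contains a cycle through uv, since u and v are already connected in F.
      cycle : connected (delete e (addEdge F e)) u v ≡ true
      cycle = Reach⇒connected _ (Reach-mono kept (connected⇒Reach F uv))
        where
        kept : ∀ y → y ∈ F → y ∈ delete e (addEdge F e)
        kept y my = delete-∈ {G = addEdge F e} (addEdge-old {F = F} F⊆E my)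
                             (λ y≡e → true≢false (trans (sym (mem-intro {L = F} (subst (_∈ F) y≡e my))) old))

    addsEdge-as-∑ : ∀ F' → F' ∈ subsets E → 𝟙 (addsEdge F' F) ≡ ∑ E (λ e → 𝟙 (extends-by F' e))
    addsEdge-as-∑ F' F'⊆ =
      trans (cong 𝟙 (any-cong E (λ e → cong (not (mem F e) ∧_) (agrees⇔same e))))
            (𝟙-any (extends-by F') E (allEdges-unique n) at-most-one)
      where
      agree : Bool → Bool → Bool
      agree a b = (a ∧ b) ∨ (not a ∧ not b)
      agree-true : ∀ {a b} → agree a b ≡ true → a ≡ b
      agree-true {true} {true} _ = refl
      agree-true {false} {false} _ = refl
      agree-refl : ∀ a → agree a a ≡ true
      agree-refl true = refl
      agree-refl false = refl
      agrees⇔same : ∀ e → all (λ x → agree (mem F' x) (inF+e e x)) E ≡ sameList F' (addEdge F e)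
      agrees⇔same e = bool-ext
        (λ h → subst (λ T → sameList T (addEdge F e) ≡ true)
                     (sym (trans (subset-filter (allEdges-unique n) F'⊆) (filter-cong E (λ x m → agree-true (all-true _ E h m)))))
                     (sameList-refl (addEdge F e)))
        (λ h → all-intro _ E (λ x m → subst (λ b → agree b (inF+e e x) ≡ true) (sym (mem-F' (sameList-true h) x m))
                                            (agree-refl (inF+e e x))))
        where
        mem-F' : F' ≡ addEdge F e → ∀ x → x ∈ E → mem F' x ≡ inF+e e x
        mem-F' refl x m = trans (mem-filter (inF+e e) E x) (trans (cong (inF+e e x ∧_) (mem-intro m)) (∧-identityʳ _))
      at-most-one : ∀ e e' → e ∈ E → e' ∈ E → extends-by F' e ≡ true → extends-by F' e' ≡ true → e ≡ e'
      at-most-one e e' me me' h h' with ∧-true {not (mem F e)} h | ∧-true {not (mem F e')} h'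
      ... | e-new , F'≡F+e | _ , F'≡F+e' with ∈-addEdge {F = F} {e = e'}
            (subst (e ∈_) (trans (sym (sameList-true F'≡F+e)) (sameList-true F'≡F+e')) (addEdge-new {F = F} me))
      ...   | inj₁ e≡e' = e≡e'
      ...   | inj₂ e∈F = ⊥-elim (true≢false (trans (sym (mem-intro {L = F} e∈F)) (not-true e-new)))

    ∑-extends-by : ∀ e → ∑ (forestsWith n i) (λ F' → 𝟙 (extends-by F' e) * mass w F') ≡ 𝟙 (admissible e) * mass w (addEdge F e)
    ∑-extends-by e = begin
      ∑ (forestsWith n i) (λ F' → 𝟙 (extends-by F' e) * mass w F')
        ≡⟨ trans (∑-filter (forests n) _ _) (∑-filter (subsets E) isForest _) ⟩
      ∑ (subsets E) (λ T → 𝟙 (isForest T) * (𝟙 (numComponents T ≡ᵇ i) * (𝟙 (extends-by T e) * mass w T)))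
        ≡⟨ ∑-cong' (subsets E) only-F+e ⟩
      ∑ (subsets E) (λ T → 𝟙 (sameList T (addEdge F e)) * K)
        ≡⟨ ∑-*ʳ (subsets E) K _ ⟩
      ∑ (subsets E) (λ T → 𝟙 (sameList T (addEdge F e))) * K
        ≡⟨ cong (_* K) (filter-once (allEdges-unique n) (inF+e e)) ⟩
      1 * K
        ≡⟨ +-identityʳ K ⟩
      K ∎
      where
      open ≡-Reasoning
      K = 𝟙 (admissible e) * mass w (addEdge F e)
      only-F+e : ∀ T → 𝟙 (isForest T) * (𝟙 (numComponents T ≡ᵇ i) * (𝟙 (extends-by T e) * mass w T))
                       ≡ 𝟙 (sameList T (addEdge F e)) * K
      only-F+e T with sameList T (addEdge F e) in same
      ... | true rewrite sameList-true {T = T} same | 𝟙-∧ (not (mem F e)) true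
                       | 𝟙-∧ (not (mem F e)) (isForest (addEdge F e) ∧ (numComponents (addEdge F e) ≡ᵇ i))
                       | 𝟙-∧ (isForest (addEdge F e)) (numComponents (addEdge F e) ≡ᵇ i)
        = reorder (𝟙 (not (mem F e))) (𝟙 (isForest (addEdge F e))) (𝟙 (numComponents (addEdge F e) ≡ᵇ i)) (mass w (addEdge F e))
        where
        reorder : ∀ a b c m → b * (c * ((a * 1) * m)) ≡ 1 * ((a * (b * c)) * m)
        reorder = solve-∀
      ... | false rewrite ∧-zeroʳ (not (mem F e)) | *-zeroʳ (𝟙 (numComponents T ≡ᵇ i)) = *-zeroʳ (𝟙 (isForest T))

    ∑-admissible : ∑ E (λ e → 𝟙 (admissible e) * mass w (addEdge F e))
                   ≡ mass w F * ∑ E (λ e → 𝟙 (not (connected F (proj₁ e) (proj₂ e))) * (w (proj₁ e) * w (proj₂ e)))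
    ∑-admissible = trans (∑-cong E per-edge) (∑-*ˡ E (mass w F) _)
      where
      per-edge : ∀ e → e ∈ E → 𝟙 (admissible e) * mass w (addEdge F e)
                               ≡ mass w F * (𝟙 (not (connected F (proj₁ e) (proj₂ e))) * (w (proj₁ e) * w (proj₂ e)))
      per-edge (u , v) potential rewrite admissible⇔apart u v potential with connected F u v in uv
      ... | true = sym (*-zeroʳ (mass w F))
      ... | false = trans (+-identityʳ _)
                          (trans (mass-addEdge F F⊆ u v potential (mem-false {L = F} (JoinComponents.e∉F F F⊆E forest u v potential uv)) w)
                                 (cong (mass w F *_) (sym (+-identityʳ _))))

    ∑-apart≡pairSum : ∑ E (λ e → 𝟙 (not (connected F (proj₁ e) (proj₂ e))) * (w (proj₁ e) * w (proj₂ e))) ≡ pairSum w F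
    ∑-apart≡pairSum = begin
      ∑ E (λ e → 𝟙 (not (connected F (proj₁ e) (proj₂ e))) * (w (proj₁ e) * w (proj₂ e)))
        ≡⟨ ∑-allEdges n _ ⟩
      byIndex
        ≡⟨ sym byRoots≡byIndex ⟩
      byRoots
        ≡⟨ sym (pairSum≡byRoots w F) ⟩
      pairSum w F ∎
      where
      open ≡-Reasoning
      open CrossingWeights (sameComponent F) w

    successors-mass : ∑ (forestsWith n i) (λ F' → 𝟙 (addsEdge F' F) * mass w F') ≡ mass w F * pairSum w F
    successors-mass = begin
      ∑ (forestsWith n i) (λ F' → 𝟙 (addsEdge F' F) * mass w F')
        ≡⟨ ∑-cong (forestsWith n i) (λ F' m → trans (cong (_* mass w F') (addsEdge-as-∑ F' (proj₁ (forestsWith-member m))))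
                                                   (sym (∑-*ʳ E (mass w F') _))) ⟩
      ∑ (forestsWith n i) (λ F' → ∑ E (λ e → 𝟙 (extends-by F' e) * mass w F'))
        ≡⟨ ∑-swap (forestsWith n i) E _ ⟩
      ∑ E (λ e → ∑ (forestsWith n i) (λ F' → 𝟙 (extends-by F' e) * mass w F'))
        ≡⟨ ∑-cong' E ∑-extends-by ⟩
      ∑ E (λ e → 𝟙 (admissible e) * mass w (addEdge F e))
        ≡⟨ ∑-admissible ⟩
      mass w F * ∑ E (λ e → 𝟙 (not (connected F (proj₁ e) (proj₂ e))) * (w (proj₁ e) * w (proj₂ e)))
        ≡⟨ cong (mass w F *_) ∑-apart≡pairSum ⟩
      mass w F * pairSum w F ∎
      where open ≡-Reasoning

module Fractions where

  open import Defs using (sumℚ; _÷_)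
  open FiniteSums using (∑)
  open import Data.Nat using (ℕ; suc; _+_; _*_)
  import Data.Nat.Properties as ℕ
  open import Data.Integer using (+_) renaming (_+_ to _+ℤ_; _*_ to _*ℤ_)
  import Data.Integer.Properties as ℤ
  open import Data.Integer.Tactic.RingSolver using (solve-∀)
  open import Data.Rational using (ℚ; 0ℚ; _/_; fromℚᵘ) renaming (_+_ to _+ℚ_; _*_ to _*ℚ_)
  import Data.Rational.Properties as ℚ
  open import Data.Rational.Unnormalised using (ℚᵘ; mkℚᵘ; *≡*) renaming (_+_ to _+ᵘ_; _*_ to _*ᵘ_)
  import Data.Rational.Unnormalised.Properties as ℚᵘ
  open import Data.List using (List; []; _∷_; map)
  open import Data.List.Membership.Propositional using (_∈_)
  open import Data.List.Relation.Unary.Any using (here; there)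
  open import Relation.Binary.PropositionalEquality

  -- Fractions of naturals with a fixed positive denominator, computed in ℚ by
  -- passing through unnormalised rationals, where equality is cross-multiplication.

  fromℚᵘ-+ : ∀ p q → fromℚᵘ p +ℚ fromℚᵘ q ≡ fromℚᵘ (p +ᵘ q)
  fromℚᵘ-+ p q = ℚ.toℚᵘ-injective
    (ℚᵘ.≃-trans (ℚ.toℚᵘ-homo-+ (fromℚᵘ p) (fromℚᵘ q))
      (ℚᵘ.≃-trans (ℚᵘ.+-cong (ℚ.toℚᵘ-fromℚᵘ p) (ℚ.toℚᵘ-fromℚᵘ q)) (ℚᵘ.≃-sym (ℚ.toℚᵘ-fromℚᵘ (p +ᵘ q)))))

  fromℚᵘ-* : ∀ p q → fromℚᵘ p *ℚ fromℚᵘ q ≡ fromℚᵘ (p *ᵘ q)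
  fromℚᵘ-* p q = ℚ.toℚᵘ-injective
    (ℚᵘ.≃-trans (ℚ.toℚᵘ-homo-* (fromℚᵘ p) (fromℚᵘ q))
      (ℚᵘ.≃-trans (ℚᵘ.*-cong (ℚ.toℚᵘ-fromℚᵘ p) (ℚ.toℚᵘ-fromℚᵘ q)) (ℚᵘ.≃-sym (ℚ.toℚᵘ-fromℚᵘ (p *ᵘ q)))))

  /-+ : ∀ a b d → (+ a) / suc d +ℚ (+ b) / suc d ≡ (+ (a + b)) / suc d
  /-+ a b d = trans (fromℚᵘ-+ (mkℚᵘ (+ a) d) (mkℚᵘ (+ b) d)) (ℚ.fromℚᵘ-cong (*≡* {mkℚᵘ (+ a) d +ᵘ mkℚᵘ (+ b) d} {mkℚᵘ (+ (a + b)) d} cross))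
    where
    D = suc d
    cross : ((+ a) *ℤ (+ D) +ℤ (+ b) *ℤ (+ D)) *ℤ (+ D) ≡ (+ (a + b)) *ℤ (+ (D * D))
    cross rewrite ℤ.pos-+ a b | sym (ℤ.pos-* D D) = distrib (+ a) (+ b) (+ D)
      where
      distrib : ∀ x y z → (x *ℤ z +ℤ y *ℤ z) *ℤ z ≡ (x +ℤ y) *ℤ (z *ℤ z)
      distrib = solve-∀

  0/suc : ∀ d → (+ 0) / suc d ≡ 0ℚ
  0/suc d = ℚ.0/n≡0 (suc d)

  cancel-/ : ∀ a d → (+ (a * suc d)) / suc d ≡ (+ a) / 1
  cancel-/ a d = ℚ.fromℚᵘ-cong (*≡* {mkℚᵘ (+ (a * suc d)) d} {mkℚᵘ (+ a) 0} (trans (ℤ.*-identityʳ (+ (a * suc d))) (ℤ.pos-* a (suc d))))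

  cancel-* : ∀ s k → ((+ suc k) / 1) *ℚ ((+ s) / suc k) ≡ (+ s) / 1
  cancel-* s k = trans (fromℚᵘ-* (mkℚᵘ (+ suc k) 0) (mkℚᵘ (+ s) k)) (ℚ.fromℚᵘ-cong (*≡* {mkℚᵘ (+ suc k) 0 *ᵘ mkℚᵘ (+ s) k} {mkℚᵘ (+ s) 0} cross))
    where
    cross : ((+ suc k) *ℤ (+ s)) *ℤ (+ 1) ≡ (+ s) *ℤ (+ (1 * suc k))
    cross rewrite ℕ.*-identityˡ (suc k) = trans (ℤ.*-identityʳ _) (ℤ.*-comm (+ suc k) (+ s))

  ÷-suc : ∀ x {d p} → d ≡ suc p → x ÷ d ≡ (+ x) / suc p
  ÷-suc x refl = refl

  sumℚ-cong : ∀ {A : Set} (L : List A) {f g : A → ℚ} → (∀ x → x ∈ L → f x ≡ g x) → sumℚ (map f L) ≡ sumℚ (map g L)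
  sumℚ-cong [] h = refl
  sumℚ-cong (x ∷ L) h = cong₂ _+ℚ_ (h x (here refl)) (sumℚ-cong L (λ y m → h y (there m)))

  sumℚ-/ : ∀ {A : Set} (L : List A) (f : A → ℕ) d → sumℚ (map (λ x → (+ f x) / suc d) L) ≡ (+ ∑ L f) / suc d
  sumℚ-/ [] f d = sym (0/suc d)
  sumℚ-/ (x ∷ L) f d = trans (cong ((+ f x) / suc d +ℚ_) (sumℚ-/ L f d)) (/-+ (f x) (∑ L f) d)

  sumℚ-+ : ∀ {A : Set} (L : List A) (f g : A → ℚ) →
           sumℚ (map (λ x → f x +ℚ g x) L) ≡ sumℚ (map f L) +ℚ sumℚ (map g L)
  sumℚ-+ [] f g = sym (ℚ.+-identityʳ 0ℚ)
  sumℚ-+ (x ∷ L) f g rewrite sumℚ-+ L f g = interchange (f x) (g x) (sumℚ (map f L)) (sumℚ (map g L))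
    where
    open import Algebra.Bundles using (CommutativeMonoid)
    open import Algebra.Properties.CommutativeSemigroup
      (CommutativeMonoid.commutativeSemigroup ℚ.+-0-commutativeMonoid) using (interchange)

  sumℚ-swap : ∀ {A B : Set} (L : List A) (M : List B) (f : A → B → ℚ) →
              sumℚ (map (λ a → sumℚ (map (f a) M)) L) ≡ sumℚ (map (λ b → sumℚ (map (λ a → f a b) L)) M)
  sumℚ-swap [] M f = sym (zeros M)
    where
    zeros : ∀ {B : Set} (M : List B) → sumℚ (map (λ _ → 0ℚ) M) ≡ 0ℚ
    zeros [] = refl
    zeros (x ∷ M) rewrite zeros M = ℚ.+-identityʳ 0ℚ
  sumℚ-swap (x ∷ L) M f =
    trans (cong (sumℚ (map (f x) M) +ℚ_) (sumℚ-swap L M f)) (sym (sumℚ-+ M (f x) (λ b → sumℚ (map (λ a → f a b) L))))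

open import Defs
open BooleanReflection
open FiniteSums
open PairSums
open EdgeSets
open Transitions
open Fractions
open import Data.Nat using (ℕ; zero; suc; _*_; _≤_; _<_; s≤s)
open import Data.Nat.Properties using (+-identityʳ; module ≤-Reasoning)
open import Data.Fin using (Fin) renaming (zero to fz)
open import Data.List using (List; []; _∷_; map; allFin)
open import Data.List.Membership.Propositional using (_∈_)
open import Data.Nat.ListAction using (sum)
open import Data.Bool using (true; false; if_then_else_)
open import Data.Product using (_×_; _,_; Σ; proj₁; proj₂)
open import Data.Integer using (+_)
open import Data.Rational using (0ℚ; _/_) renaming (_*_ to _*ℚ_)
open import Relation.Binary.PropositionalEquality

guarded-fraction : ∀ b x {d p} → d ≡ suc p → (if b then x ÷ d else 0ℚ) ≡ (+ (𝟙 b * x)) / suc p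
guarded-fraction true x {p = p} refl = cong (λ m → (+ m) / suc p) (sym (+-identityʳ x))
guarded-fraction false x {p = p} refl = sym (0/suc p)

∑φ≡mass : ∀ {n} (w : Fin n → ℕ) → (∀ j → 1 ≤ w j) → Fin n → ∀ i → 1 ≤ i →
          ∀ F → F ∈ forestsWith n (suc i) → sumℚ (map (λ F' → φ w F' F) (forestsWith n i)) ≡ (+ mass w F) / 1
∑φ≡mass {n} w w≥1 x₀ i i≥1 F m = evaluate (positive⇒suc (pairSum-positive w w≥1 x₀ F two-components))
  where
  open ≡-Reasoning
  L = forestsWith n i
  member = forestsWith-member m
  two-components : 2 ≤ numComponents F
  two-components = subst (2 ≤_) (sym (proj₂ (proj₂ member))) (s≤s i≥1)
  evaluate : Σ ℕ (λ p → pairSum w F ≡ suc p) → sumℚ (map (λ F' → φ w F' F) L) ≡ (+ mass w F) / 1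
  evaluate (p , pairs) = begin
    sumℚ (map (λ F' → φ w F' F) L)
      ≡⟨ sumℚ-cong L (λ F' _ → guarded-fraction (addsEdge F' F) (mass w F') pairs) ⟩
    sumℚ (map (λ F' → (+ (𝟙 (addsEdge F' F) * mass w F')) / suc p) L)
      ≡⟨ sumℚ-/ L (λ F' → 𝟙 (addsEdge F' F) * mass w F') p ⟩
    (+ ∑ L (λ F' → 𝟙 (addsEdge F' F) * mass w F')) / suc p
      ≡⟨ cong (λ x → (+ x) / suc p) (Successors.successors-mass w i F (proj₁ member) (proj₁ (proj₂ member)) (proj₂ (proj₂ member))) ⟩
    (+ (mass w F * pairSum w F)) / suc p
      ≡⟨ cong (λ x → (+ (mass w F * x)) / suc p) pairs ⟩
    (+ (mass w F * suc p)) / suc p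
      ≡⟨ cancel-/ (mass w F) p ⟩
    (+ mass w F) / 1 ∎

∑∑φ≡∑mass : ∀ {n} (w : Fin n → ℕ) → (∀ j → 1 ≤ w j) → Fin n → ∀ i → 1 ≤ i →
            sumℚ (map (λ F' → sumℚ (map (λ F → φ w F' F) (forestsWith n (suc i)))) (forestsWith n i))
              ≡ (+ sum (map (mass w) (forestsWith n (suc i)))) / 1
∑∑φ≡∑mass {n} w w≥1 x₀ i i≥1 = begin
  sumℚ (map (λ F' → sumℚ (map (λ F → φ w F' F) 𝓕ᵢ₊₁)) 𝓕ᵢ)
    ≡⟨ sumℚ-swap 𝓕ᵢ 𝓕ᵢ₊₁ (λ F' F → φ w F' F) ⟩
  sumℚ (map (λ F → sumℚ (map (λ F' → φ w F' F) 𝓕ᵢ)) 𝓕ᵢ₊₁)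
    ≡⟨ sumℚ-cong 𝓕ᵢ₊₁ (∑φ≡mass w w≥1 x₀ i i≥1) ⟩
  sumℚ (map (λ F → (+ mass w F) / 1) 𝓕ᵢ₊₁)
    ≡⟨ sumℚ-/ 𝓕ᵢ₊₁ (mass w) 0 ⟩
  (+ ∑ 𝓕ᵢ₊₁ (mass w)) / 1
    ≡⟨ cong (λ x → (+ x) / 1) (sym (sum-map 𝓕ᵢ₊₁ (mass w))) ⟩
  (+ sum (map (mass w) 𝓕ᵢ₊₁)) / 1 ∎
  where
  open ≡-Reasoning
  𝓕ᵢ = forestsWith n i
  𝓕ᵢ₊₁ = forestsWith n (suc i)

-- The empty forest has mass 1, so K ≥ 1.
Kconst-positive : ∀ {n} (w : Fin n → ℕ) → 1 ≤ Kconst w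
Kconst-positive {n} w = begin
  1                        ≡⟨ sym (trans (product-map (allFin n) (λ j → 1)) (ones (allFin n))) ⟩
  mass w []                ≤⟨ term≤∑ (forests n) (mass w) (filter-∈ isForest (subsets (allEdges n)) ([]∈subsets (allEdges n)) refl) ⟩
  ∑ (forests n) (mass w)   ≡⟨ sym (sum-map (forests n) (mass w)) ⟩
  Kconst w ∎
  where
  open ≤-Reasoning
  ones : ∀ (L : List (Fin n)) → ∏ L (λ _ → 1) ≡ 1
  ones [] = refl
  ones (x ∷ L) = trans (+-identityʳ _) (ones L)

-- For any set A of forests, K · P(𝐅 ∈ A) is the total mass of A, since K ≥ 1.
K·P≡mass : ∀ {n} (w : Fin n → ℕ) (A : List (List (Edge n))) →
           (+ sum (map (mass w) A)) / 1 ≡ ((+ Kconst w) / 1) *ℚ probIn w A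
K·P≡mass w A = sym (evaluate (positive⇒suc (Kconst-positive w)))
  where
  open ≡-Reasoning
  evaluate : Σ ℕ (λ k → Kconst w ≡ suc k) → ((+ Kconst w) / 1) *ℚ probIn w A ≡ (+ sum (map (mass w) A)) / 1
  evaluate (k , K≡1+k) = begin
    ((+ Kconst w) / 1) *ℚ probIn w A
      ≡⟨ cong₂ _*ℚ_ (cong (λ x → (+ x) / 1) K≡1+k) (sumℚ-cong A (λ F _ → ÷-suc (mass w F) K≡1+k)) ⟩
    ((+ suc k) / 1) *ℚ sumℚ (map (λ F → (+ mass w F) / suc k) A)
      ≡⟨ cong (((+ suc k) / 1) *ℚ_) (sumℚ-/ A (mass w) k) ⟩
    ((+ suc k) / 1) *ℚ ((+ ∑ A (mass w)) / suc k)
      ≡⟨ cancel-* (∑ A (mass w)) k ⟩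
    (+ ∑ A (mass w)) / 1
      ≡⟨ cong (λ x → (+ x) / 1) (sym (sum-map A (mass w))) ⟩
    (+ sum (map (mass w) A)) / 1 ∎

lemma3 : (W n : ℕ) → 1 ≤ W → (w : Fin n → ℕ) → (∀ j → 1 ≤ w j) →
         sum (map w (allFin n)) ≡ W →
         (i : ℕ) → 1 ≤ i → i < n →
         (sumℚ (map (λ F' → sumℚ (map (λ F → φ w F' F) (forestsWith n (suc i))))
                    (forestsWith n i))
            ≡ (+ sum (map (mass w) (forestsWith n (suc i)))) / 1)
         × ((+ sum (map (mass w) (forestsWith n (suc i)))) / 1
            ≡ ((+ Kconst w) / 1) *ℚ probIn w (forestsWith n (suc i)))
lemma3 W zero _ w _ _ i _ ()
lemma3 W (suc n) _ w w≥1 _ i i≥1 _ =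
  ∑∑φ≡∑mass w w≥1 fz i i≥1 , K·P≡mass w (forestsWith (suc n) (suc i))
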